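{- Let $K',K'':\mathbb{Z}^2\to\mathbb{Z}^2$ be defined by $K'(x,y)=(-x+y+1,\,y)$ and $K''(x,y)=(x,\,x-y+1)$, and let $a,b$ be integers. Then the following hold. (1) Starting with $(a,b)$ and applying the operators $K'$ and $K''$ alternately creates a cycle with six points. If any of these points lies on one of the lines $y=-x+2$, $2y=x+1$, $y=2x-1$, then some of the cycle points overlap, forming a cycle with only three distinct points, unless $a=b=1$, in which case all six points coincide. (2) The sets $\mathscr{P}_K(a,b)$, $(a,b)\in\mathbb{Z}^2$, form a partition of $\mathbb{Z}^2$ (any two of them are equal or disjoint, and their union is $\mathbb{Z}^2$). Moreover, for an integer $T\ge1$, the average, over the $(2T+1)^2$ lattice points $(a,b)$ with $-T\le a,b\le T$, of the Euclidean length of the closed path connecting consecutively the six points of the cycle generated by $(a,b)$ equals $\frac{17}{3}T+O(1)$. (3) There are infinitely many cycles $\mathscr{P}_K(a,b)$ for which the set $\{|m| : m\in\{x,y\},\ (x,y)\in\mathscr{P}_K(a,b)\}$ contains three distinct perfect squares, and infinitely many for which it contains three distinct perfect cubes. There exist cycles $\mathscr{P}_K(a,b)$ such that every element of $\{|m| : m\in\{x,y\},\ (x,y)\in\mathscr{P}_K(a,b)\}$ is a prime number.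
   Context: For $(a,b)\in\mathbb{Z}^2$, $\mathscr{P}_K(a,b)$ denotes the set of all points obtained from $(a,b)$ by applying finitely many (possibly zero) operators from $\{K',K''\}$, in any order; it is called the cycle generated by $(a,b)$. Applying $K',K'',K',K'',K',K''$ successively to $(x,y)$ gives the points $(-x+y+1,y)$, $(-x+y+1,-x+2)$, $(-y+2,-x+2)$, $(-y+2,x-y+1)$, $(x,x-y+1)$, $(x,y)$; the closed path of the cycle connects these six points in this order (returning to the start), and its length is the sum of the Euclidean lengths of the six segments. -}

module Defs where

open import Data.Nat as ℕ using (ℕ; zero; suc)
open import Data.Integer as ℤ using (ℤ; +_; -_; ∣_∣)
open import Data.Rational as ℚ using (ℚ)
open import Data.Fin using (Fin; zero; suc)
open import Data.Product using (_×_; _,_; Σ; ∃; ∃-syntax)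
open import Data.Sum using (_⊎_)
open import Data.List using (List; map; upTo; concatMap; sum; foldr)
open import Relation.Binary.PropositionalEquality using (_≡_)
open import Relation.Nullary using (¬_)

Point : Set
Point = ℤ × ℤ

K′ : Point → Point
K′ (x , y) = (ℤ.- x ℤ.+ y ℤ.+ + 1 , y)

K″ : Point → Point
K″ (x , y) = (x , x ℤ.- y ℤ.+ + 1)

cyc : Point → Fin 6 → Point
cyc p zero = K′ p
cyc p (suc zero) = K″ (K′ p)
cyc p (suc (suc zero)) = K′ (K″ (K′ p))
cyc p (suc (suc (suc zero))) = K″ (K′ (K″ (K′ p)))
cyc p (suc (suc (suc (suc zero)))) = K′ (K″ (K′ (K″ (K′ p))))
cyc p (suc (suc (suc (suc (suc zero))))) = K″ (K′ (K″ (K′ (K″ (K′ p)))))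

next : Fin 6 → Fin 6
next zero = suc zero
next (suc zero) = suc (suc zero)
next (suc (suc zero)) = suc (suc (suc zero))
next (suc (suc (suc zero))) = suc (suc (suc (suc zero)))
next (suc (suc (suc (suc zero)))) = suc (suc (suc (suc (suc zero))))
next (suc (suc (suc (suc (suc zero))))) = zero

OnSpecialLine : Point → Set
OnSpecialLine (x , y) =
  (y ≡ ℤ.- x ℤ.+ + 2) ⊎ ((+ 2 ℤ.* y ≡ x ℤ.+ + 1) ⊎ (y ≡ + 2 ℤ.* x ℤ.- + 1))

ExactlyThreeDistinct : (Fin 6 → Point) → Set
ExactlyThreeDistinct f =
  Σ (Fin 6) λ i → Σ (Fin 6) λ j → Σ (Fin 6) λ k →
    (¬ f i ≡ f j) × (¬ f i ≡ f k) × (¬ f j ≡ f k) ×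
    ((l : Fin 6) → (f l ≡ f i) ⊎ ((f l ≡ f j) ⊎ (f l ≡ f k)))

-- Reach p q : q is obtained from p by finitely many applications of K', K''.
-- The cycle 𝒫_K(p) is the set { q | Reach p q }.
data Reach (p : Point) : Point → Set where
  here : Reach p p
  stepK′ : ∀ {q} → Reach p q → Reach p (K′ q)
  stepK″ : ∀ {q} → Reach p q → Reach p (K″ q)

SameCycle : Point → Point → Set
SameCycle p q = ∀ r → (Reach p r → Reach q r) × (Reach q r → Reach p r)

DisjointCycles : Point → Point → Set
DisjointCycles p q = ∀ r → ¬ (Reach p r × Reach q r)

InAbsCoords : Point → ℕ → Set
InAbsCoords p m = Σ Point λ r → Reach p r ×
  ((m ≡ ∣ Data.Product.proj₁ r ∣) ⊎ (m ≡ ∣ Data.Product.proj₂ r ∣))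

IsSquare : ℕ → Set
IsSquare m = ∃[ k ] m ≡ k ℕ.* k

IsCube : ℕ → Set
IsCube m = ∃[ k ] m ≡ k ℕ.* k ℕ.* k

HasThreeDistinct : (ℕ → Set) → Point → Set
HasThreeDistinct P p = Σ ℕ λ m₁ → Σ ℕ λ m₂ → Σ ℕ λ m₃ →
  (¬ m₁ ≡ m₂) × (¬ m₁ ≡ m₃) × (¬ m₂ ≡ m₃) ×
  (InAbsCoords p m₁ × P m₁) × (InAbsCoords p m₂ × P m₂) × (InAbsCoords p m₃ × P m₃)

segSq : Point → Fin 6 → ℕ
segSq p i with cyc p i | cyc p (next i)
... | (x₁ , y₁) | (x₂ , y₂) =
  ∣ x₁ ℤ.- x₂ ∣ ℕ.* ∣ x₁ ℤ.- x₂ ∣ ℕ.+ ∣ y₁ ℤ.- y₂ ∣ ℕ.* ∣ y₁ ℤ.- y₂ ∣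

range : ℕ → List ℤ
range T = map (λ i → + i ℤ.- + T) (upTo (suc (2 ℕ.* T)))

grid : ℕ → List Point
grid T = concatMap (λ a → map (λ b → (a , b)) (range T)) (range T)

sumℚ : List ℚ → ℚ
sumℚ = foldr ℚ._+_ ℚ.0ℚ

sum6 : (Fin 6 → ℚ) → ℚ
sum6 f = f zero ℚ.+ f (suc zero) ℚ.+ f (suc (suc zero)) ℚ.+ f (suc (suc (suc zero)))
  ℚ.+ f (suc (suc (suc (suc zero)))) ℚ.+ f (suc (suc (suc (suc (suc zero)))))

gridSum : ℕ → (Point → Fin 6 → ℚ) → ℚ
gridSum T u = sumℚ (map (λ p → sum6 (u p)) (grid T))

gridSize : ℕ → ℚ
gridSize T = (+ (suc (2 ℕ.* T) ℕ.* suc (2 ℕ.* T))) ℚ./ 1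

-- Since there are no reals, "Σ_p Σ_i √(segSq p i) ≤ X" is encoded as:
-- for every rational lower approximation u (0 ≤ u, u² ≤ segSq) the sum is ≤ X;
-- and "Σ ≥ Y" as: for every rational upper approximation v (0 ≤ v, v² ≥ segSq), sum ≥ Y.
LowerApprox : (Point → Fin 6 → ℚ) → Set
LowerApprox u = ∀ p i → (ℚ.0ℚ ℚ.≤ u p i) × (u p i ℚ.* u p i ℚ.≤ (+ segSq p i) ℚ./ 1)

UpperApprox : (Point → Fin 6 → ℚ) → Set
UpperApprox v = ∀ p i → (ℚ.0ℚ ℚ.≤ v p i) × ((+ segSq p i) ℚ./ 1 ℚ.≤ v p i ℚ.* v p i)

AverageLengthBound : ℚ → ℕ → Set
AverageLengthBound C T =
  ((u : Point → Fin 6 → ℚ) → LowerApprox u →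
     gridSum T u ℚ.≤ ((+ (17 ℕ.* T)) ℚ./ 3 ℚ.+ C) ℚ.* gridSize T) ×
  ((v : Point → Fin 6 → ℚ) → UpperApprox v →
     ((+ (17 ℕ.* T)) ℚ./ 3 ℚ.- C) ℚ.* gridSize T ℚ.≤ gridSum T v)

module Submission where

open import Defs
open import Data.Nat using (ℕ; _≤_)
open import Data.Integer using (ℤ; +_)
open import Data.Rational using (ℚ)
open import Data.Fin using (Fin; fromℕ)
open import Data.Product using (_×_; _,_; Σ)
open import Data.Sum using (_⊎_)
open import Data.List using (List)
open import Data.List.Relation.Unary.All using (All)
open import Data.Nat.Primality using (Prime)
open import Relation.Binary.PropositionalEquality using (_≡_)
open import Relation.Nullary using (¬_)

open import Data.Fin using (zero; suc)
open import Data.Product using (proj₁; proj₂)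
open import Data.Sum using (inj₁; inj₂)
open import Data.List using ([]; _∷_; map)
open import Data.Nat.ListAction using (sum)
open import Relation.Binary.PropositionalEquality using (refl; sym; trans; cong; cong₂; subst; module ≡-Reasoning)

-- Put ℓ₁ = x + y - 2, ℓ₂ = x - 2y + 1 and ℓ₃ = 2x - y - 1; the three special lines are ℓᵢ = 0 and
-- meet at (1, 1). K′ and K″ are the reflections in ℓ₃ = 0 and ℓ₂ = 0, and each permutes ℓ₁, ℓ₂, ℓ₃
-- up to sign. Hence K″ ∘ K′ has order three, so the cycle closes after six steps; whether some ℓᵢ
-- vanishes is a cycle invariant, and a degenerate cycle through p ≠ (1, 1) has exactly one point on
-- each line. Consecutive points of a cycle differ in a single coordinate, by |ℓᵢ(p)|, so the closed
-- path has length 2 (|ℓ₁| + |ℓ₂| + |ℓ₃|)(p); that quantity is another cycle invariant. Summing it over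
-- the square, with the constants in the ℓᵢ dropped at a cost O(T²), reduces to the one-dimensional
-- sums Σ_{|b| ≤ T} |b + c| = c² + T (T + 1) for |c| ≤ T (a coefficient 2 is removed by writing
-- |2b + 2q + r| = |b + q| + |b + q + r| for r ≤ 1), and gives 17 T (T + 1) (2 T + 1) / 3 + O(T²),
-- i.e. an average path length of 17 T / 3 + O(1).
-- Points with a large invariant lie on new cycles, and the cycle of (u, v) contains
-- K″ (u, v) = (u, u - v + 1), so solutions of u + 1 = v + w give three coordinates u, v, w:
-- x² + 1 = z² + y² for squares and (9t⁴ + 3t)³ + 1 = (9t⁴)³ + (9t³ + 1)³ for cubes.

module Reflections where
  open import Data.Integer using (_+_; _-_; _*_; -_; 0ℤ)
  open import Data.Integer.Properties using (neg-involutive; neg-injective; +-identityʳ; *-cancelˡ-≡)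
  open import Data.Integer.Tactic.RingSolver using (solve-∀)

  ℓ₁ ℓ₂ ℓ₃ : Point → ℤ
  ℓ₁ (x , y) = x + y - + 2
  ℓ₂ (x , y) = x - + 2 * y + + 1
  ℓ₃ (x , y) = + 2 * x - y - + 1

  centre : Point
  centre = (+ 1 , + 1)

  ℓ-injective : ∀ {p q} → ℓ₁ p ≡ ℓ₁ q → ℓ₂ p ≡ ℓ₂ q → p ≡ q
  ℓ-injective {x , y} {x′ , y′} e₁ e₂ = cong₂ _,_ x≡x′ y≡y′
    where
    3y-from-ℓ : ∀ x y → + 3 * y ≡ (x + y - + 2) - (x - + 2 * y + + 1) + + 3
    3y-from-ℓ = solve-∀
    x-from-ℓ : ∀ x y → x ≡ (x + y - + 2) - y + + 2
    x-from-ℓ = solve-∀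
    y≡y′ : y ≡ y′
    y≡y′ = *-cancelˡ-≡ (+ 3) y y′
             (trans (3y-from-ℓ x y) (trans (cong₂ (λ l m → l - m + + 3) e₁ e₂) (sym (3y-from-ℓ x′ y′))))
    x≡x′ : x ≡ x′
    x≡x′ = trans (x-from-ℓ x y) (trans (cong₂ (λ l t → l - t + + 2) e₁ y≡y′) (sym (x-from-ℓ x′ y′)))

  ℓ₁-K′ : ∀ p → ℓ₁ (K′ p) ≡ - ℓ₂ p
  ℓ₁-K′ (x , y) = identity x y
    where identity : ∀ x y → (- x + y + + 1) + y - + 2 ≡ - (x - + 2 * y + + 1)
          identity = solve-∀

  ℓ₂-K′ : ∀ p → ℓ₂ (K′ p) ≡ - ℓ₁ p
  ℓ₂-K′ (x , y) = identity x y
    where identity : ∀ x y → (- x + y + + 1) - + 2 * y + + 1 ≡ - (x + y - + 2)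
          identity = solve-∀

  ℓ₃-K′ : ∀ p → ℓ₃ (K′ p) ≡ - ℓ₃ p
  ℓ₃-K′ (x , y) = identity x y
    where identity : ∀ x y → + 2 * (- x + y + + 1) - y - + 1 ≡ - (+ 2 * x - y - + 1)
          identity = solve-∀

  ℓ₁-K″ : ∀ p → ℓ₁ (K″ p) ≡ ℓ₃ p
  ℓ₁-K″ (x , y) = identity x y
    where identity : ∀ x y → x + (x - y + + 1) - + 2 ≡ + 2 * x - y - + 1
          identity = solve-∀

  ℓ₂-K″ : ∀ p → ℓ₂ (K″ p) ≡ - ℓ₂ p
  ℓ₂-K″ (x , y) = identity x y
    where identity : ∀ x y → x - + 2 * (x - y + + 1) + + 1 ≡ - (x - + 2 * y + + 1)
          identity = solve-∀

  ℓ₃-K″ : ∀ p → ℓ₃ (K″ p) ≡ ℓ₁ p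
  ℓ₃-K″ (x , y) = identity x y
    where identity : ∀ x y → + 2 * x - (x - y + + 1) - + 1 ≡ x + y - + 2
          identity = solve-∀

  ℓ₂≡ℓ₃-ℓ₁ : ∀ p → ℓ₂ p ≡ ℓ₃ p - ℓ₁ p
  ℓ₂≡ℓ₃-ℓ₁ (x , y) = identity x y
    where identity : ∀ x y → x - + 2 * y + + 1 ≡ (+ 2 * x - y - + 1) - (x + y - + 2)
          identity = solve-∀

  ℓ₁≡ℓ₃-ℓ₂ : ∀ p → ℓ₁ p ≡ ℓ₃ p - ℓ₂ p
  ℓ₁≡ℓ₃-ℓ₂ (x , y) = identity x y
    where identity : ∀ x y → x + y - + 2 ≡ (+ 2 * x - y - + 1) - (x - + 2 * y + + 1)
          identity = solve-∀

  K′-involutive : ∀ p → K′ (K′ p) ≡ p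
  K′-involutive (x , y) = cong (_, y) (identity x y)
    where identity : ∀ x y → - (- x + y + + 1) + y + + 1 ≡ x
          identity = solve-∀

  K″-involutive : ∀ p → K″ (K″ p) ≡ p
  K″-involutive (x , y) = cong (x ,_) (identity x y)
    where identity : ∀ x y → x - (x - y + + 1) + + 1 ≡ y
          identity = solve-∀

  ℓ₃≡0⇒K′-fixed : ∀ {p} → ℓ₃ p ≡ 0ℤ → K′ p ≡ p
  ℓ₃≡0⇒K′-fixed {x , y} h = cong (_, y) (trans (identity x y) (trans (cong (λ t → x - t) h) (+-identityʳ x)))
    where identity : ∀ x y → - x + y + + 1 ≡ x - (+ 2 * x - y - + 1)
          identity = solve-∀

  ℓ₂≡0⇒K″-fixed : ∀ {p} → ℓ₂ p ≡ 0ℤ → K″ p ≡ p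
  ℓ₂≡0⇒K″-fixed {x , y} h = cong (x ,_) (trans (identity x y) (trans (cong (λ t → y + t) h) (+-identityʳ y)))
    where identity : ∀ x y → x - y + + 1 ≡ y + (x - + 2 * y + + 1)
          identity = solve-∀

  -i≡0⇒i≡0 : ∀ {i} → - i ≡ 0ℤ → i ≡ 0ℤ
  -i≡0⇒i≡0 = neg-injective {j = 0ℤ}

  ℓ₁∩ℓ₂⇒centre : ∀ {u} → ℓ₁ u ≡ 0ℤ → ℓ₂ u ≡ 0ℤ → u ≡ centre
  ℓ₁∩ℓ₂⇒centre = ℓ-injective

  ℓ₁∩ℓ₃⇒centre : ∀ {u} → ℓ₁ u ≡ 0ℤ → ℓ₃ u ≡ 0ℤ → u ≡ centre
  ℓ₁∩ℓ₃⇒centre {u} h₁ h₃ = ℓ₁∩ℓ₂⇒centre h₁ (trans (ℓ₂≡ℓ₃-ℓ₁ u) (cong₂ _-_ h₃ h₁))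

  ℓ₂∩ℓ₃⇒centre : ∀ {u} → ℓ₂ u ≡ 0ℤ → ℓ₃ u ≡ 0ℤ → u ≡ centre
  ℓ₂∩ℓ₃⇒centre {u} h₂ h₃ = ℓ₁∩ℓ₂⇒centre (trans (ℓ₁≡ℓ₃-ℓ₂ u) (cong₂ _-_ h₃ h₂)) h₂

  rotate : Point → Point
  rotate p = K″ (K′ p)

  ℓ₁-rotate : ∀ p → ℓ₁ (rotate p) ≡ - ℓ₃ p
  ℓ₁-rotate p = trans (ℓ₁-K″ (K′ p)) (ℓ₃-K′ p)

  ℓ₂-rotate : ∀ p → ℓ₂ (rotate p) ≡ ℓ₁ p
  ℓ₂-rotate p = trans (ℓ₂-K″ (K′ p)) (trans (cong -_ (ℓ₂-K′ p)) (neg-involutive (ℓ₁ p)))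

  ℓ₃-rotate : ∀ p → ℓ₃ (rotate p) ≡ - ℓ₂ p
  ℓ₃-rotate p = trans (ℓ₃-K″ (K′ p)) (ℓ₁-K′ p)

  rotate³≡id : ∀ p → rotate (rotate (rotate p)) ≡ p
  rotate³≡id p = ℓ-injective ℓ₁-eq ℓ₂-eq
    where
    open ≡-Reasoning
    ℓ₁-eq : ℓ₁ (rotate (rotate (rotate p))) ≡ ℓ₁ p
    ℓ₁-eq = begin
      ℓ₁ (rotate (rotate (rotate p)))  ≡⟨ ℓ₁-rotate (rotate (rotate p)) ⟩
      - ℓ₃ (rotate (rotate p))         ≡⟨ cong -_ (ℓ₃-rotate (rotate p)) ⟩
      - - ℓ₂ (rotate p)                ≡⟨ neg-involutive (ℓ₂ (rotate p)) ⟩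
      ℓ₂ (rotate p)                    ≡⟨ ℓ₂-rotate p ⟩
      ℓ₁ p                             ∎
    ℓ₂-eq : ℓ₂ (rotate (rotate (rotate p))) ≡ ℓ₂ p
    ℓ₂-eq = begin
      ℓ₂ (rotate (rotate (rotate p)))  ≡⟨ ℓ₂-rotate (rotate (rotate p)) ⟩
      ℓ₁ (rotate (rotate p))           ≡⟨ ℓ₁-rotate (rotate p) ⟩
      - ℓ₃ (rotate p)                  ≡⟨ cong -_ (ℓ₃-rotate p) ⟩
      - - ℓ₂ p                         ≡⟨ neg-involutive (ℓ₂ p) ⟩
      ℓ₂ p                             ∎

  cyc-period : ∀ p → cyc p (fromℕ 5) ≡ p
  cyc-period = rotate³≡id

open Reflections

module Cycles where
  open import Data.Integer using (-_; 0ℤ)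
  open import Data.Integer.Tactic.RingSolver using (solve-∀)
  open import Function using (flip)
  open import Data.Fin.Properties using (any?; all?)
  open import Data.Product.Properties using (≡-dec)
  open import Data.Nat.Primality using (prime?)
  open import Relation.Nullary using (Dec; yes; no)
  open import Relation.Nullary.Decidable using (toWitness; _×-dec_)
  import Data.Integer as ℤ

  Reach-trans : ∀ {p q r} → Reach p q → Reach q r → Reach p r
  Reach-trans p↝q here       = p↝q
  Reach-trans p↝q (stepK′ h) = stepK′ (Reach-trans p↝q h)
  Reach-trans p↝q (stepK″ h) = stepK″ (Reach-trans p↝q h)

  Reach-sym : ∀ {p q} → Reach p q → Reach q p
  Reach-sym here           = here
  Reach-sym (stepK′ {q} h) = Reach-trans (subst (Reach (K′ q)) (K′-involutive q) (stepK′ here)) (Reach-sym h)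
  Reach-sym (stepK″ {q} h) = Reach-trans (subst (Reach (K″ q)) (K″-involutive q) (stepK″ here)) (Reach-sym h)

  centre-fixed : ∀ {q} → Reach centre q → q ≡ centre
  centre-fixed here = refl
  centre-fixed (stepK′ h) rewrite centre-fixed h = refl
  centre-fixed (stepK″ h) rewrite centre-fixed h = refl

  Reach-cyc : ∀ p i → Reach p (cyc p i)
  Reach-cyc p zero                                = stepK′ here
  Reach-cyc p (suc zero)                          = stepK″ (stepK′ here)
  Reach-cyc p (suc (suc zero))                    = stepK′ (stepK″ (stepK′ here))
  Reach-cyc p (suc (suc (suc zero)))              = stepK″ (stepK′ (stepK″ (stepK′ here)))
  Reach-cyc p (suc (suc (suc (suc zero))))        = stepK′ (stepK″ (stepK′ (stepK″ (stepK′ here))))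
  Reach-cyc p (suc (suc (suc (suc (suc zero))))) = stepK″ (stepK′ (stepK″ (stepK′ (stepK″ (stepK′ here)))))

  InCycle : Point → Point → Set
  InCycle p q = Σ (Fin 6) λ i → cyc p i ≡ q

  InCycle-K′ : ∀ {p q} → InCycle p q → InCycle p (K′ q)
  InCycle-K′ {p} (zero , refl) = fromℕ 5 , trans (cyc-period p) (sym (K′-involutive p))
  InCycle-K′ (suc zero , refl) = suc (suc zero) , refl
  InCycle-K′ {p} (suc (suc zero) , refl) = suc zero , sym (K′-involutive (cyc p (suc zero)))
  InCycle-K′ (suc (suc (suc zero)) , refl) = suc (suc (suc (suc zero))) , refl
  InCycle-K′ {p} (suc (suc (suc (suc zero))) , refl) =
    suc (suc (suc zero)) , sym (K′-involutive (cyc p (suc (suc (suc zero)))))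
  InCycle-K′ {p} (suc (suc (suc (suc (suc zero)))) , refl) = zero , cong K′ (sym (cyc-period p))

  InCycle-K″ : ∀ {p q} → InCycle p q → InCycle p (K″ q)
  InCycle-K″ (zero , refl) = suc zero , refl
  InCycle-K″ {p} (suc zero , refl) = zero , sym (K″-involutive (cyc p zero))
  InCycle-K″ (suc (suc zero) , refl) = suc (suc (suc zero)) , refl
  InCycle-K″ {p} (suc (suc (suc zero)) , refl) =
    suc (suc zero) , sym (K″-involutive (cyc p (suc (suc zero))))
  InCycle-K″ (suc (suc (suc (suc zero))) , refl) = suc (suc (suc (suc (suc zero)))) , refl
  InCycle-K″ {p} (suc (suc (suc (suc (suc zero)))) , refl) =
    suc (suc (suc (suc zero))) , sym (K″-involutive (cyc p (suc (suc (suc (suc zero))))))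

  Reach⇒InCycle : ∀ {p q} → Reach p q → InCycle p q
  Reach⇒InCycle {p} here   = fromℕ 5 , cyc-period p
  Reach⇒InCycle (stepK′ h) = InCycle-K′ (Reach⇒InCycle h)
  Reach⇒InCycle (stepK″ h) = InCycle-K″ (Reach⇒InCycle h)

  Reach⇒SameCycle : ∀ {p q} → Reach p q → SameCycle p q
  Reach⇒SameCycle p↝q r = Reach-trans (Reach-sym p↝q) , Reach-trans p↝q

  Degenerate : Point → Set
  Degenerate p = ℓ₁ p ≡ 0ℤ ⊎ ℓ₂ p ≡ 0ℤ ⊎ ℓ₃ p ≡ 0ℤ

  OnSpecialLine⇒Degenerate : ∀ q → OnSpecialLine q → Degenerate q
  OnSpecialLine⇒Degenerate (x , y) (inj₁ e) =
    inj₁ (trans (cong (λ t → x ℤ.+ t ℤ.- + 2) e) (identity x))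
    where identity : ∀ x → x ℤ.+ (- x ℤ.+ + 2) ℤ.- + 2 ≡ 0ℤ
          identity = solve-∀
  OnSpecialLine⇒Degenerate (x , y) (inj₂ (inj₁ e)) =
    inj₂ (inj₁ (trans (cong (λ t → x ℤ.- t ℤ.+ + 1) e) (identity x)))
    where identity : ∀ x → x ℤ.- (x ℤ.+ + 1) ℤ.+ + 1 ≡ 0ℤ
          identity = solve-∀
  OnSpecialLine⇒Degenerate (x , y) (inj₂ (inj₂ e)) =
    inj₂ (inj₂ (trans (cong (λ t → + 2 ℤ.* x ℤ.- t ℤ.- + 1) e) (identity x)))
    where identity : ∀ x → + 2 ℤ.* x ℤ.- (+ 2 ℤ.* x ℤ.- + 1) ℤ.- + 1 ≡ 0ℤ
          identity = solve-∀

  Degenerate-K′ : ∀ q → Degenerate (K′ q) → Degenerate q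
  Degenerate-K′ q (inj₁ h)        = inj₂ (inj₁ (-i≡0⇒i≡0 (trans (sym (ℓ₁-K′ q)) h)))
  Degenerate-K′ q (inj₂ (inj₁ h)) = inj₁ (-i≡0⇒i≡0 (trans (sym (ℓ₂-K′ q)) h))
  Degenerate-K′ q (inj₂ (inj₂ h)) = inj₂ (inj₂ (-i≡0⇒i≡0 (trans (sym (ℓ₃-K′ q)) h)))

  Degenerate-K″ : ∀ q → Degenerate (K″ q) → Degenerate q
  Degenerate-K″ q (inj₁ h)        = inj₂ (inj₂ (trans (sym (ℓ₁-K″ q)) h))
  Degenerate-K″ q (inj₂ (inj₁ h)) = inj₂ (inj₁ (-i≡0⇒i≡0 (trans (sym (ℓ₂-K″ q)) h)))
  Degenerate-K″ q (inj₂ (inj₂ h)) = inj₁ (trans (sym (ℓ₃-K″ q)) h)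

  Degenerate-Reach : ∀ {p q} → Reach p q → Degenerate q → Degenerate p
  Degenerate-Reach here           d = d
  Degenerate-Reach (stepK′ {q} h) d = Degenerate-Reach h (Degenerate-K′ q d)
  Degenerate-Reach (stepK″ {q} h) d = Degenerate-Reach h (Degenerate-K″ q d)

  on-different-lines⇒≢ : ∀ {p u v} (f g : Point → ℤ) → ¬ p ≡ centre → Reach p u →
                         (f u ≡ 0ℤ → g u ≡ 0ℤ → u ≡ centre) → f u ≡ 0ℤ → g v ≡ 0ℤ → ¬ u ≡ v
  on-different-lines⇒≢ {p} f g p≢centre p↝u meet fu≡0 gv≡0 refl =
    p≢centre (centre-fixed (subst (λ c → Reach c p) (meet fu≡0 gv≡0) (Reach-sym p↝u)))

  ExactlyThreeDistinct-intro : ∀ {f : Fin 6 → Point} {u v w} (i j k : Fin 6) → f i ≡ u → f j ≡ v → f k ≡ w →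
                               ¬ u ≡ v → ¬ u ≡ w → ¬ v ≡ w → (∀ l → f l ≡ u ⊎ f l ≡ v ⊎ f l ≡ w) →
                               ExactlyThreeDistinct f
  ExactlyThreeDistinct-intro i j k refl refl refl u≢v u≢w v≢w cover = i , j , k , u≢v , u≢w , v≢w , cover

  Degenerate⇒ExactlyThreeDistinct : ∀ {p} → Degenerate p → ¬ p ≡ centre → ExactlyThreeDistinct (cyc p)
  Degenerate⇒ExactlyThreeDistinct {p} (inj₂ (inj₂ h)) p≢centre =
    ExactlyThreeDistinct-intro zero (suc zero) (suc (suc zero)) e₀ e₁ e₂
      (on-different-lines⇒≢ ℓ₃ ℓ₁ p≢centre here (flip ℓ₁∩ℓ₃⇒centre) h q∈ℓ₁)
      (on-different-lines⇒≢ ℓ₃ ℓ₂ p≢centre here (flip ℓ₂∩ℓ₃⇒centre) h s∈ℓ₂)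
      (on-different-lines⇒≢ ℓ₁ ℓ₂ p≢centre (stepK″ here) ℓ₁∩ℓ₂⇒centre q∈ℓ₁ s∈ℓ₂)
      λ { zero → inj₁ e₀ ; (suc zero) → inj₂ (inj₁ e₁) ; (suc (suc zero)) → inj₂ (inj₂ e₂)
        ; (suc (suc (suc zero))) → inj₂ (inj₂ e₃) ; (suc (suc (suc (suc zero)))) → inj₂ (inj₁ e₄)
        ; (suc (suc (suc (suc (suc zero))))) → inj₁ (cyc-period p) }
    where
    q = K″ p
    s = K′ q
    q∈ℓ₁ : ℓ₁ q ≡ 0ℤ
    q∈ℓ₁ = trans (ℓ₁-K″ p) h
    s∈ℓ₂ : ℓ₂ s ≡ 0ℤ
    s∈ℓ₂ = trans (ℓ₂-K′ q) (cong -_ q∈ℓ₁)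
    e₀ : cyc p zero ≡ p
    e₀ = ℓ₃≡0⇒K′-fixed h
    e₁ : cyc p (suc zero) ≡ q
    e₁ = cong K″ e₀
    e₂ : cyc p (suc (suc zero)) ≡ s
    e₂ = cong K′ e₁
    e₃ : cyc p (suc (suc (suc zero))) ≡ s
    e₃ = trans (cong K″ e₂) (ℓ₂≡0⇒K″-fixed s∈ℓ₂)
    e₄ : cyc p (suc (suc (suc (suc zero)))) ≡ q
    e₄ = trans (cong K′ e₃) (K′-involutive q)
  Degenerate⇒ExactlyThreeDistinct {p} (inj₂ (inj₁ h)) p≢centre =
    ExactlyThreeDistinct-intro zero (suc zero) (suc (suc (suc (suc zero)))) refl refl e₄
      (on-different-lines⇒≢ ℓ₁ ℓ₃ p≢centre (stepK′ here) ℓ₁∩ℓ₃⇒centre q∈ℓ₁ s∈ℓ₃)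
      (on-different-lines⇒≢ ℓ₁ ℓ₂ p≢centre (stepK′ here) ℓ₁∩ℓ₂⇒centre q∈ℓ₁ h)
      (on-different-lines⇒≢ ℓ₃ ℓ₂ p≢centre (stepK″ (stepK′ here)) (flip ℓ₂∩ℓ₃⇒centre) s∈ℓ₃ h)
      λ { zero → inj₁ refl ; (suc zero) → inj₂ (inj₁ refl) ; (suc (suc zero)) → inj₂ (inj₁ e₂)
        ; (suc (suc (suc zero))) → inj₁ e₃ ; (suc (suc (suc (suc zero)))) → inj₂ (inj₂ e₄)
        ; (suc (suc (suc (suc (suc zero))))) → inj₂ (inj₂ (cyc-period p)) }
    where
    q = K′ p
    s = K″ q
    q∈ℓ₁ : ℓ₁ q ≡ 0ℤ
    q∈ℓ₁ = trans (ℓ₁-K′ p) (cong -_ h)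
    s∈ℓ₃ : ℓ₃ s ≡ 0ℤ
    s∈ℓ₃ = trans (ℓ₃-K″ q) q∈ℓ₁
    e₂ : cyc p (suc (suc zero)) ≡ s
    e₂ = ℓ₃≡0⇒K′-fixed s∈ℓ₃
    e₃ : cyc p (suc (suc (suc zero))) ≡ q
    e₃ = trans (cong K″ e₂) (K″-involutive q)
    e₄ : cyc p (suc (suc (suc (suc zero)))) ≡ p
    e₄ = trans (cong K′ e₃) (K′-involutive p)
  Degenerate⇒ExactlyThreeDistinct {p} (inj₁ h) p≢centre =
    ExactlyThreeDistinct-intro zero (suc (suc zero)) (suc (suc (suc zero))) refl e₂ e₃
      (on-different-lines⇒≢ ℓ₂ ℓ₁ p≢centre (stepK′ here) (flip ℓ₁∩ℓ₂⇒centre) q∈ℓ₂ h)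
      (on-different-lines⇒≢ ℓ₂ ℓ₃ p≢centre (stepK′ here) ℓ₂∩ℓ₃⇒centre q∈ℓ₂ s∈ℓ₃)
      (on-different-lines⇒≢ ℓ₁ ℓ₃ p≢centre here ℓ₁∩ℓ₃⇒centre h s∈ℓ₃)
      λ { zero → inj₁ refl ; (suc zero) → inj₁ e₁ ; (suc (suc zero)) → inj₂ (inj₁ e₂)
        ; (suc (suc (suc zero))) → inj₂ (inj₂ e₃) ; (suc (suc (suc (suc zero)))) → inj₂ (inj₂ e₄)
        ; (suc (suc (suc (suc (suc zero))))) → inj₂ (inj₁ (cyc-period p)) }
    where
    q = K′ p
    s = K″ p
    q∈ℓ₂ : ℓ₂ q ≡ 0ℤ
    q∈ℓ₂ = trans (ℓ₂-K′ p) (cong -_ h)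
    s∈ℓ₃ : ℓ₃ s ≡ 0ℤ
    s∈ℓ₃ = trans (ℓ₃-K″ p) h
    e₁ : cyc p (suc zero) ≡ q
    e₁ = ℓ₂≡0⇒K″-fixed q∈ℓ₂
    e₂ : cyc p (suc (suc zero)) ≡ p
    e₂ = trans (cong K′ e₁) (K′-involutive p)
    e₃ : cyc p (suc (suc (suc zero))) ≡ s
    e₃ = cong K″ e₂
    e₄ : cyc p (suc (suc (suc (suc zero)))) ≡ s
    e₄ = trans (cong K′ e₃) (ℓ₃≡0⇒K′-fixed s∈ℓ₃)

  _≟_ : (p q : Point) → Dec (p ≡ q)
  _≟_ = ≡-dec ℤ._≟_ ℤ._≟_

  SameCycle⊎DisjointCycles : (p q : Point) → SameCycle p q ⊎ DisjointCycles p q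
  SameCycle⊎DisjointCycles p q with any? (λ i → cyc p i ≟ q)
  ... | yes (i , cyc≡q) = inj₁ (Reach⇒SameCycle (subst (Reach p) cyc≡q (Reach-cyc p i)))
  ... | no q∉cycle      = inj₂ λ r (p↝r , q↝r) → q∉cycle (Reach⇒InCycle (Reach-trans p↝r (Reach-sym q↝r)))

  primeCycle : Σ Point (λ p → (m : ℕ) → InAbsCoords p m → Prime m)
  primeCycle = p₀ , λ { m (r , p₀↝r , m≡) → prime-coordinate (Reach⇒InCycle p₀↝r) m≡ }
    where
    -- The coordinates along its cycle are ±5, ±7, ±11 and ±13.
    p₀ : Point
    p₀ = (+ 7 , - + 5)
    coordinates-prime : ∀ i → Prime ℤ.∣ proj₁ (cyc p₀ i) ∣ × Prime ℤ.∣ proj₂ (cyc p₀ i) ∣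
    coordinates-prime = toWitness {a? = all? (λ i → prime? _ ×-dec prime? _)} _
    prime-coordinate : ∀ {r m} → InCycle p₀ r → m ≡ ℤ.∣ proj₁ r ∣ ⊎ m ≡ ℤ.∣ proj₂ r ∣ → Prime m
    prime-coordinate (i , refl) (inj₁ refl) = proj₁ (coordinates-prime i)
    prime-coordinate (i , refl) (inj₂ refl) = proj₂ (coordinates-prime i)

open Cycles

module LatticeSums where
  open import Data.Nat using (zero; suc; _+_; _*_; _∸_; z≤n; s≤s; _/_; _%_)
  open import Data.Nat.Properties
  open import Data.Nat.DivMod using (m≡m%n+[m/n]*n; m%n<n)
  open import Data.Nat.Tactic.RingSolver using (solve-∀)
  open import Data.Nat.ListAction.Properties using (sum-++)
  open import Data.List using (applyUpTo; concatMap; _++_; [_])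
  import Data.List.Properties as List
  import Data.Integer as ℤ
  import Data.Integer.Properties as ℤP
  open import Data.Integer using (∣_∣; _⊖_; -[1+_])
  import Data.Integer.Tactic.RingSolver as ℤ-Solver

  symSum : ℕ → (ℤ → ℕ) → ℕ
  symSum zero    f = f (+ 0)
  symSum (suc T) f = f (ℤ.- + suc T) + symSum T f + f (+ suc T)

  symSum-cong : ∀ T {f g} → (∀ c → ∣ c ∣ ≤ T → f c ≡ g c) → symSum T f ≡ symSum T g
  symSum-cong zero    f≗g = f≗g (+ 0) z≤n
  symSum-cong (suc T) f≗g =
    cong₂ _+_ (cong₂ _+_ (f≗g _ ≤-refl) (symSum-cong T λ c c≤T → f≗g c (m≤n⇒m≤1+n c≤T))) (f≗g _ ≤-refl)

  symSum-mono : ∀ T {f g} → (∀ c → ∣ c ∣ ≤ T → f c ≤ g c) → symSum T f ≤ symSum T g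
  symSum-mono zero    f≤g = f≤g (+ 0) z≤n
  symSum-mono (suc T) f≤g =
    +-mono-≤ (+-mono-≤ (f≤g _ ≤-refl) (symSum-mono T λ c c≤T → f≤g c (m≤n⇒m≤1+n c≤T))) (f≤g _ ≤-refl)

  symSum-+ : ∀ T f g → symSum T (λ c → f c + g c) ≡ symSum T f + symSum T g
  symSum-+ zero    f g = refl
  symSum-+ (suc T) f g rewrite symSum-+ T f g =
    interchange (f (ℤ.- + suc T)) (g (ℤ.- + suc T)) (symSum T f) (symSum T g) (f (+ suc T)) (g (+ suc T))
    where interchange : ∀ a a′ s s′ b b′ → a + a′ + (s + s′) + (b + b′) ≡ a + s + b + (a′ + s′ + b′)
          interchange = solve-∀

  symSum-*ˡ : ∀ T k f → symSum T (λ c → k * f c) ≡ k * symSum T f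
  symSum-*ˡ zero    k f = refl
  symSum-*ˡ (suc T) k f rewrite symSum-*ˡ T k f = distrib k (f (ℤ.- + suc T)) (symSum T f) (f (+ suc T))
    where distrib : ∀ k a s b → k * a + k * s + k * b ≡ k * (a + s + b)
          distrib = solve-∀

  symSum-const : ∀ T k → symSum T (λ _ → k) ≡ suc (2 * T) * k
  symSum-const zero    k = sym (+-identityʳ k)
  symSum-const (suc T) k rewrite symSum-const T k = count T k
    where count : ∀ T k → k + (1 + 2 * T) * k + k ≡ (1 + 2 * (1 + T)) * k
          count = solve-∀

  symSum-swap : ∀ S T (f : ℤ → ℤ → ℕ) →
                symSum S (λ a → symSum T (f a)) ≡ symSum T (λ b → symSum S (λ a → f a b))
  symSum-swap zero    T f = refl
  symSum-swap (suc S) T f = begin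
    symSum T (f (ℤ.- + suc S)) + symSum S (λ a → symSum T (f a)) + symSum T (f (+ suc S))
      ≡⟨ cong (λ s → symSum T (f (ℤ.- + suc S)) + s + symSum T (f (+ suc S))) (symSum-swap S T f) ⟩
    symSum T (f (ℤ.- + suc S)) + symSum T (λ b → symSum S (λ a → f a b)) + symSum T (f (+ suc S))
      ≡⟨ cong (_+ symSum T (f (+ suc S))) (symSum-+ T (f (ℤ.- + suc S)) _) ⟨
    symSum T (λ b → f (ℤ.- + suc S) b + symSum S (λ a → f a b)) + symSum T (f (+ suc S))
      ≡⟨ symSum-+ T _ (f (+ suc S)) ⟨
    symSum T (λ b → symSum (suc S) (λ a → f a b))  ∎
    where open ≡-Reasoning

  symSum-reflect : ∀ T f → symSum T (λ c → f (ℤ.- c)) ≡ symSum T f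
  symSum-reflect zero    f = refl
  symSum-reflect (suc T) f rewrite symSum-reflect T f = swap-ends (f (ℤ.- + suc T)) (symSum T f) (f (+ suc T))
    where swap-ends : ∀ a s b → b + s + a ≡ a + s + b
          swap-ends = solve-∀

  symSum-squares : ∀ T → 3 * symSum T (λ c → ∣ c ∣ * ∣ c ∣) ≡ T * suc T * suc (2 * T)
  symSum-squares zero    = refl
  symSum-squares (suc T) = begin
    3 * (suc T * suc T + S + suc T * suc T)              ≡⟨ collect (suc T * suc T) S ⟩
    3 * S + 6 * (suc T * suc T)                          ≡⟨ cong (_+ 6 * (suc T * suc T)) (symSum-squares T) ⟩
    T * suc T * suc (2 * T) + 6 * (suc T * suc T)        ≡⟨ step T ⟩
    suc T * suc (suc T) * suc (2 * suc T)                ∎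
    where
    open ≡-Reasoning
    S = symSum T (λ c → ∣ c ∣ * ∣ c ∣)
    collect : ∀ a S → 3 * (a + S + a) ≡ 3 * S + 6 * a
    collect = solve-∀
    step : ∀ T → T * (1 + T) * (1 + 2 * T) + 6 * ((1 + T) * (1 + T)) ≡ (1 + T) * (2 + T) * (1 + 2 * (1 + T))
    step = solve-∀

  symSum-suc : ∀ T f → symSum (suc T) f ≡ f (ℤ.- + suc T) + f (+ suc T) + symSum T f
  symSum-suc T f = move-ends (f (ℤ.- + suc T)) (symSum T f) (f (+ suc T))
    where move-ends : ∀ a s b → a + s + b ≡ a + b + s
          move-ends = solve-∀

  Σ² : ℕ → (ℤ → ℤ → ℕ) → ℕ
  Σ² T f = symSum T (λ a → symSum T (f a))

  Σ²-+ : ∀ T f g → Σ² T (λ a b → f a b + g a b) ≡ Σ² T f + Σ² T g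
  Σ²-+ T f g = trans (symSum-cong T λ a _ → symSum-+ T (f a) (g a)) (symSum-+ T _ _)

  Σ²-mono : ∀ T {f g} → (∀ a b → f a b ≤ g a b) → Σ² T f ≤ Σ² T g
  Σ²-mono T f≤g = symSum-mono T λ a _ → symSum-mono T λ b _ → f≤g a b

  Σ²-const : ∀ T k → Σ² T (λ _ _ → k) ≡ suc (2 * T) * suc (2 * T) * k
  Σ²-const T k = begin
    symSum T (λ _ → symSum T (λ _ → k))  ≡⟨ symSum-cong T (λ _ _ → symSum-const T k) ⟩
    symSum T (λ _ → suc (2 * T) * k)     ≡⟨ symSum-const T _ ⟩
    suc (2 * T) * (suc (2 * T) * k)      ≡⟨ *-assoc (suc (2 * T)) (suc (2 * T)) k ⟨
    suc (2 * T) * suc (2 * T) * k        ∎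
    where open ≡-Reasoning

  Σ²-*ˡ : ∀ T k f → Σ² T (λ a b → k * f a b) ≡ k * Σ² T f
  Σ²-*ˡ T k f = trans (symSum-cong T λ a _ → symSum-*ˡ T k (f a)) (symSum-*ˡ T k _)

  sum-applyUpTo-cong : ∀ n {h h′ : ℕ → ℕ} → (∀ i → h i ≡ h′ i) →
                       sum (applyUpTo h n) ≡ sum (applyUpTo h′ n)
  sum-applyUpTo-cong zero    _    = refl
  sum-applyUpTo-cong (suc n) h≗h′ = cong₂ _+_ (h≗h′ 0) (sum-applyUpTo-cong n (λ i → h≗h′ (suc i)))

  sum-applyUpTo-ends : ∀ n (h : ℕ → ℕ) →
    sum (applyUpTo h (suc (suc n))) ≡ h 0 + h (suc n) + sum (applyUpTo (λ i → h (suc i)) n)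
  sum-applyUpTo-ends n h = begin
    h 0 + sum (applyUpTo h′ (suc n))          ≡⟨ cong (λ xs → h 0 + sum xs) (List.applyUpTo-∷ʳ h′ n) ⟨
    h 0 + sum (applyUpTo h′ n ++ [ h′ n ])    ≡⟨ cong (λ t → h 0 + t) (sum-++ (applyUpTo h′ n) [ h′ n ]) ⟩
    h 0 + (sum (applyUpTo h′ n) + (h′ n + 0)) ≡⟨ move (h 0) (sum (applyUpTo h′ n)) (h′ n) ⟩
    h 0 + h′ n + sum (applyUpTo h′ n)         ∎
    where
    open ≡-Reasoning
    h′ = λ i → h (suc i)
    move : ∀ a s b → a + (s + (b + 0)) ≡ a + b + s
    move = solve-∀

  sum-range : ∀ T f → sum (map f (range T)) ≡ symSum T f
  sum-range T f =
    trans (cong sum (trans (cong (map f) (List.map-upTo g (suc (2 * T)))) (List.map-applyUpTo g f (suc (2 * T)))))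
          (centred T)
    where
    g : ℕ → ℤ
    g i = + i ℤ.- + T
    centred : ∀ T → sum (applyUpTo (λ i → f (+ i ℤ.- + T)) (suc (2 * T))) ≡ symSum T f
    centred zero    = +-identityʳ (f (+ 0))
    centred (suc T) = begin
      sum (applyUpTo h (suc (2 * suc T)))          ≡⟨ cong (λ n → sum (applyUpTo h (suc n))) (*-suc 2 T) ⟩
      sum (applyUpTo h (suc (suc (suc (2 * T)))))  ≡⟨ sum-applyUpTo-ends (suc (2 * T)) h ⟩
      h 0 + h (suc (suc (2 * T))) + sum (applyUpTo (λ i → h (suc i)) (suc (2 * T)))
        ≡⟨ cong₂ (λ s t → f (ℤ.- + suc T) + f s + t) (top (+ T))
                 (sum-applyUpTo-cong (suc (2 * T)) (λ i → cong f (shift (+ i) (+ T)))) ⟩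
      f (ℤ.- + suc T) + f (+ suc T) + sum (applyUpTo (λ i → f (+ i ℤ.- + T)) (suc (2 * T)))
        ≡⟨ cong (λ t → f (ℤ.- + suc T) + f (+ suc T) + t) (centred T) ⟩
      f (ℤ.- + suc T) + f (+ suc T) + symSum T f   ≡⟨ symSum-suc T f ⟨
      symSum (suc T) f                              ∎
      where
      open ≡-Reasoning
      h : ℕ → ℕ
      h i = f (+ i ℤ.- + suc T)
      top : ∀ T → + 1 ℤ.+ (+ 1 ℤ.+ (T ℤ.+ (T ℤ.+ + 0))) ℤ.- (+ 1 ℤ.+ T) ≡ + 1 ℤ.+ T
      top = ℤ-Solver.solve-∀
      shift : ∀ i T → (+ 1 ℤ.+ i) ℤ.- (+ 1 ℤ.+ T) ≡ i ℤ.- T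
      shift = ℤ-Solver.solve-∀

  sum-concatMap : ∀ {A B : Set} (g : A → List B) (f : B → ℕ) xs →
    sum (map f (concatMap g xs)) ≡ sum (map (λ a → sum (map f (g a))) xs)
  sum-concatMap g f []       = refl
  sum-concatMap g f (x ∷ xs) = begin
    sum (map f (g x ++ concatMap g xs))                ≡⟨ cong sum (List.map-++ f (g x) (concatMap g xs)) ⟩
    sum (map f (g x) ++ map f (concatMap g xs))        ≡⟨ sum-++ (map f (g x)) _ ⟩
    sum (map f (g x)) + sum (map f (concatMap g xs))   ≡⟨ cong (λ t → sum (map f (g x)) + t) (sum-concatMap g f xs) ⟩
    sum (map f (g x)) + sum (map (λ a → sum (map f (g a))) xs)  ∎
    where open ≡-Reasoning

  sum-grid : ∀ T f → sum (map f (grid T)) ≡ Σ² T (λ a b → f (a , b))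
  sum-grid T f = begin
    sum (map f (grid T))
      ≡⟨ sum-concatMap (λ a → map (a ,_) (range T)) f (range T) ⟩
    sum (map (λ a → sum (map f (map (a ,_) (range T)))) (range T))  ≡⟨ cong sum (List.map-cong inner (range T)) ⟩
    sum (map (λ a → symSum T (λ b → f (a , b))) (range T))          ≡⟨ sum-range T _ ⟩
    Σ² T (λ a b → f (a , b))                                        ∎
    where
    open ≡-Reasoning
    inner : ∀ a → sum (map f (map (a ,_) (range T))) ≡ symSum T (λ b → f (a , b))
    inner a = trans (cong sum (sym (List.map-∘ (range T)))) (sum-range T _)

  distSum : ℕ → ℤ → ℕ
  distSum T c = symSum T (λ b → ∣ b ℤ.+ c ∣)

  ∣-k+n∣+[k+n]≡2k : ∀ {k n} → n ≤ k → ∣ ℤ.- + k ℤ.+ + n ∣ + (k + n) ≡ 2 * k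
  ∣-k+n∣+[k+n]≡2k {k} {n} n≤k = begin
    ∣ ℤ.- + k ℤ.+ + n ∣ + (k + n)  ≡⟨ cong (λ t → ∣ t ∣ + (k + n)) (ℤP.-m+n≡n⊖m k n) ⟩
    ∣ n ⊖ k ∣ + (k + n)            ≡⟨ cong (_+ (k + n)) (ℤP.∣⊖∣-≤ n≤k) ⟩
    k ∸ n + (k + n)                ≡⟨ regroup (k ∸ n) k n ⟩
    k + (k ∸ n + n)                ≡⟨ cong (λ t → k + t) (m∸n+n≡m n≤k) ⟩
    k + k                          ≡⟨ cong (λ t → k + t) (+-identityʳ k) ⟨
    2 * k                          ∎
    where open ≡-Reasoning
          regroup : ∀ d k n → d + (k + n) ≡ k + (d + n)
          regroup = solve-∀

  ∣-k+n∣+[k+n]≡2n : ∀ {k n} → k ≤ n → ∣ ℤ.- + k ℤ.+ + n ∣ + (k + n) ≡ 2 * n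
  ∣-k+n∣+[k+n]≡2n {k} {n} k≤n = begin
    ∣ ℤ.- + k ℤ.+ + n ∣ + (k + n)  ≡⟨ cong (λ t → ∣ t ∣ + (k + n)) (ℤP.-m+n≡n⊖m k n) ⟩
    ∣ n ⊖ k ∣ + (k + n)            ≡⟨ cong (_+ (k + n)) (trans (ℤP.∣m⊖n∣≡∣n⊖m∣ n k) (ℤP.∣⊖∣-≤ k≤n)) ⟩
    n ∸ k + (k + n)                ≡⟨ +-assoc (n ∸ k) k n ⟨
    n ∸ k + k + n                  ≡⟨ cong (_+ n) (m∸n+n≡m k≤n) ⟩
    n + n                          ≡⟨ cong (λ t → n + t) (+-identityʳ n) ⟨
    2 * n                          ∎
    where open ≡-Reasoning

  distSum-outside : ∀ T n → T ≤ n → distSum T (+ n) ≡ suc (2 * T) * n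
  distSum-outside zero    n _   = sym (+-identityʳ n)
  distSum-outside (suc T) n T<n = begin
    distSum (suc T) (+ n)                                    ≡⟨ symSum-suc T _ ⟩
    ∣ ℤ.- + suc T ℤ.+ + n ∣ + (suc T + n) + distSum T (+ n)
      ≡⟨ cong₂ _+_ (∣-k+n∣+[k+n]≡2n T<n) (distSum-outside T n (<⇒≤ T<n)) ⟩
    2 * n + suc (2 * T) * n                                  ≡⟨ count T n ⟩
    suc (2 * suc T) * n                                      ∎
    where open ≡-Reasoning
          count : ∀ T n → 2 * n + (1 + 2 * T) * n ≡ (1 + 2 * (1 + T)) * n
          count = solve-∀

  distSum-inside : ∀ T n → n ≤ T → distSum T (+ n) ≡ n * n + T * suc T
  distSum-inside zero    zero    _    = refl
  distSum-inside (suc T) n       n≤1+T with m≤n⇒m<n∨m≡n n≤1+T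
  ... | inj₂ refl = trans (distSum-outside (suc T) (suc T) ≤-refl) (edge T)
    where edge : ∀ T → (1 + 2 * (1 + T)) * (1 + T) ≡ (1 + T) * (1 + T) + (1 + T) * (2 + T)
          edge = solve-∀
  ... | inj₁ (s≤s n≤T) = begin
    distSum (suc T) (+ n)                                    ≡⟨ symSum-suc T _ ⟩
    ∣ ℤ.- + suc T ℤ.+ + n ∣ + (suc T + n) + distSum T (+ n)
      ≡⟨ cong₂ _+_ (∣-k+n∣+[k+n]≡2k n≤1+T) (distSum-inside T n n≤T) ⟩
    2 * suc T + (n * n + T * suc T)                          ≡⟨ count T n ⟩
    n * n + suc T * suc (suc T)                              ∎
    where open ≡-Reasoning
          count : ∀ T n → 2 * (1 + T) + (n * n + T * (1 + T)) ≡ n * n + (1 + T) * (2 + T)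
          count = solve-∀

  distSum-neg : ∀ T c → distSum T (ℤ.- c) ≡ distSum T c
  distSum-neg T c = trans (sym (symSum-reflect T (λ b → ∣ b ℤ.+ ℤ.- c ∣)))
    (symSum-cong T λ b _ → trans (cong ∣_∣ (sym (ℤP.neg-distrib-+ b c))) (ℤP.∣-i∣≡∣i∣ (b ℤ.+ c)))

  distSum-closed : ∀ T c → ∣ c ∣ ≤ T → distSum T c ≡ ∣ c ∣ * ∣ c ∣ + T * suc T
  distSum-closed T (+ n)      n≤T = distSum-inside T n n≤T
  distSum-closed T -[1+ n ]   n<T = trans (distSum-neg T (+ suc n)) (distSum-inside T (suc n) n<T)

  -- x and x + r never have opposite signs.
  ∣x+[x+r]∣≡∣x∣+∣x+r∣ : ∀ x r → r ≤ 1 → ∣ x ℤ.+ (x ℤ.+ + r) ∣ ≡ ∣ x ∣ + ∣ x ℤ.+ + r ∣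
  ∣x+[x+r]∣≡∣x∣+∣x+r∣ (+ n)        r             _        = refl
  ∣x+[x+r]∣≡∣x∣+∣x+r∣ -[1+ n ]     zero          _        = cong suc (sym (+-suc n n))
  ∣x+[x+r]∣≡∣x∣+∣x+r∣ -[1+ zero ]  (suc zero)    _        = refl
  ∣x+[x+r]∣≡∣x∣+∣x+r∣ -[1+ suc n ] (suc zero)    _        = cong (λ t → suc (suc t)) (sym (+-suc n n))
  ∣x+[x+r]∣≡∣x∣+∣x+r∣ -[1+ _ ]     (suc (suc _)) (s≤s ())

  doubledDistSum : ℕ → ℤ → ℕ
  doubledDistSum T c = symSum T (λ b → ∣ b ℤ.+ b ℤ.+ c ∣)

  doubledDistSum-halves : ∀ T q r → r ≤ 1 →
    doubledDistSum T (+ (q + (q + r))) ≡ distSum T (+ q) + distSum T (+ (q + r))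
  doubledDistSum-halves T q r r≤1 = trans (symSum-cong T λ b _ → split b) (symSum-+ T _ _)
    where
    regroup : ∀ b Q R → b ℤ.+ b ℤ.+ (Q ℤ.+ (Q ℤ.+ R)) ≡ (b ℤ.+ Q) ℤ.+ ((b ℤ.+ Q) ℤ.+ R)
    regroup = ℤ-Solver.solve-∀
    split : ∀ b → ∣ b ℤ.+ b ℤ.+ + (q + (q + r)) ∣ ≡ ∣ b ℤ.+ + q ∣ + ∣ b ℤ.+ + (q + r) ∣
    split b = begin
      ∣ b ℤ.+ b ℤ.+ + (q + (q + r)) ∣           ≡⟨ cong ∣_∣ (regroup b (+ q) (+ r)) ⟩
      ∣ (b ℤ.+ + q) ℤ.+ ((b ℤ.+ + q) ℤ.+ + r) ∣  ≡⟨ ∣x+[x+r]∣≡∣x∣+∣x+r∣ (b ℤ.+ + q) r r≤1 ⟩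
      ∣ b ℤ.+ + q ∣ + ∣ (b ℤ.+ + q) ℤ.+ + r ∣    ≡⟨ cong (λ t → ∣ b ℤ.+ + q ∣ + ∣ t ∣) (ℤP.+-assoc b (+ q) (+ r)) ⟩
      ∣ b ℤ.+ + q ∣ + ∣ b ℤ.+ + (q + r) ∣        ∎
      where open ≡-Reasoning

  doubledDistSum-neg : ∀ T c → doubledDistSum T (ℤ.- c) ≡ doubledDistSum T c
  doubledDistSum-neg T c = trans (sym (symSum-reflect T (λ b → ∣ b ℤ.+ b ℤ.+ ℤ.- c ∣)))
    (symSum-cong T λ b _ → trans (cong ∣_∣ (negate b c)) (ℤP.∣-i∣≡∣i∣ (b ℤ.+ b ℤ.+ c)))
    where negate : ∀ b c → ℤ.- b ℤ.+ ℤ.- b ℤ.+ ℤ.- c ≡ ℤ.- (b ℤ.+ b ℤ.+ c)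
          negate = ℤ-Solver.solve-∀

  doubledDistSum-closed : ∀ T q r → r ≤ 1 → q + (q + r) ≤ T →
    2 * doubledDistSum T (+ (q + (q + r))) ≡ (q + (q + r)) * (q + (q + r)) + r * r + 4 * (T * suc T)
  doubledDistSum-closed T q r r≤1 n≤T = begin
    2 * doubledDistSum T (+ (q + (q + r)))                     ≡⟨ cong (2 *_) (doubledDistSum-halves T q r r≤1) ⟩
    2 * (distSum T (+ q) + distSum T (+ (q + r)))              ≡⟨ cong₂ (λ s t → 2 * (s + t)) q-closed q+r-closed ⟩
    2 * (q * q + T * suc T + ((q + r) * (q + r) + T * suc T))  ≡⟨ halves q r T ⟩
    (q + (q + r)) * (q + (q + r)) + r * r + 4 * (T * suc T)    ∎
    where
    open ≡-Reasoning
    q-closed = distSum-inside T q (≤-trans (m≤m+n q (q + r)) n≤T)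
    q+r-closed = distSum-inside T (q + r) (≤-trans (m≤n+m (q + r) q) n≤T)
    halves : ∀ q r T → 2 * (q * q + T * (1 + T) + ((q + r) * (q + r) + T * (1 + T)))
                       ≡ (q + (q + r)) * (q + (q + r)) + r * r + 4 * (T * (1 + T))
    halves = solve-∀

  doubledDistSum-parity : ∀ T n → n ≤ T → 2 * doubledDistSum T (+ n) ≡ n * n + n % 2 * (n % 2) + 4 * (T * suc T)
  doubledDistSum-parity T n =
    subst (λ m → m ≤ T → 2 * doubledDistSum T (+ m) ≡ m * m + r * r + 4 * (T * suc T))
          (sym n≡q+[q+r]) (doubledDistSum-closed T q r (≤-pred (m%n<n n 2)))
    where
    q = n / 2
    r = n % 2
    n≡q+[q+r] : n ≡ q + (q + r)
    n≡q+[q+r] = trans (m≡m%n+[m/n]*n n 2) (halve r q)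
      where halve : ∀ r q → r + q * 2 ≡ q + (q + r)
            halve = solve-∀

  doubledDistSum-bounds : ∀ T c → ∣ c ∣ ≤ T →
    ∣ c ∣ * ∣ c ∣ + 4 * (T * suc T) ≤ 2 * doubledDistSum T c ×
    2 * doubledDistSum T c ≤ ∣ c ∣ * ∣ c ∣ + (4 * (T * suc T) + 1)
  doubledDistSum-bounds T -[1+ n ] n<T rewrite doubledDistSum-neg T (+ suc n) = doubledDistSum-bounds T (+ suc n) n<T
  doubledDistSum-bounds T (+ n)    n≤T = lower , upper
    where
    r = n % 2
    r*r≤1 : r * r ≤ 1
    r*r≤1 = *-mono-≤ (≤-pred (m%n<n n 2)) (≤-pred (m%n<n n 2))
    lower : n * n + 4 * (T * suc T) ≤ 2 * doubledDistSum T (+ n)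
    lower = ≤-trans (+-monoˡ-≤ (4 * (T * suc T)) (m≤m+n (n * n) (r * r)))
                    (≤-reflexive (sym (doubledDistSum-parity T n n≤T)))
    upper : 2 * doubledDistSum T (+ n) ≤ n * n + (4 * (T * suc T) + 1)
    upper = begin
      2 * doubledDistSum T (+ n)             ≡⟨ doubledDistSum-parity T n n≤T ⟩
      n * n + r * r + 4 * (T * suc T)        ≡⟨ swap (n * n) (r * r) (4 * (T * suc T)) ⟩
      n * n + (4 * (T * suc T) + r * r)      ≤⟨ +-monoʳ-≤ (n * n) (+-monoʳ-≤ (4 * (T * suc T)) r*r≤1) ⟩
      n * n + (4 * (T * suc T) + 1)          ∎
      where open ≤-Reasoning
            swap : ∀ a b c → a + b + c ≡ a + (c + b)
            swap = solve-∀

  symSum-squares+const : ∀ T k →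
    3 * symSum T (λ c → ∣ c ∣ * ∣ c ∣ + k) ≡ T * suc T * suc (2 * T) + 3 * (suc (2 * T) * k)
  symSum-squares+const T k = begin
    3 * symSum T (λ c → ∣ c ∣ * ∣ c ∣ + k)      ≡⟨ cong (3 *_) (symSum-+ T _ _) ⟩
    3 * (S + symSum T (λ _ → k))                ≡⟨ *-distribˡ-+ 3 S (symSum T (λ _ → k)) ⟩
    3 * S + 3 * symSum T (λ _ → k)              ≡⟨ cong₂ _+_ (symSum-squares T) (cong (3 *_) (symSum-const T k)) ⟩
    T * suc T * suc (2 * T) + 3 * (suc (2 * T) * k)  ∎
    where
    open ≡-Reasoning
    S = symSum T (λ c → ∣ c ∣ * ∣ c ∣)

  hexNorm₀ : ℤ → ℤ → ℕ
  hexNorm₀ a b = ∣ b ℤ.+ a ∣ + ∣ b ℤ.+ b ℤ.- a ∣ + ∣ a ℤ.+ a ℤ.- b ∣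

  Σ²hexNorm₀ : ∀ T → Σ² T hexNorm₀ ≡ symSum T (distSum T) + symSum T (λ a → 2 * doubledDistSum T a)
  Σ²hexNorm₀ T = begin
    Σ² T hexNorm₀                                          ≡⟨ Σ²-+ T _ _ ⟩
    Σ² T (λ a b → ∣ b ℤ.+ a ∣ + ∣ b ℤ.+ b ℤ.- a ∣) + Σ² T (λ a b → ∣ a ℤ.+ a ℤ.- b ∣)
                                                           ≡⟨ cong₂ _+_ (Σ²-+ T _ _) (symSum-swap T T _) ⟩
    symSum T (distSum T) + D + D                           ≡⟨ +-assoc (symSum T (distSum T)) D D ⟩
    symSum T (distSum T) + (D + D)                         ≡⟨ cong (λ t → symSum T (distSum T) + t) twiceD ⟩
    symSum T (distSum T) + symSum T (λ a → 2 * doubledDistSum T a)  ∎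
    where
    open ≡-Reasoning
    D = symSum T (λ a → doubledDistSum T (ℤ.- a))
    twiceD : D + D ≡ symSum T (λ a → 2 * doubledDistSum T a)
    twiceD = trans (cong (λ t → D + t) (sym (+-identityʳ D)))
                   (trans (sym (symSum-*ˡ T 2 _)) (symSum-cong T λ a _ → cong (2 *_) (doubledDistSum-neg T a)))

  3*symSum-distSum : ∀ T → 3 * symSum T (distSum T) ≡ T * suc T * suc (2 * T) + 3 * (suc (2 * T) * (T * suc T))
  3*symSum-distSum T = trans (cong (3 *_) (symSum-cong T (distSum-closed T))) (symSum-squares+const T _)

  3*symSum-doubledDistSum-bounds : ∀ T →
    T * suc T * suc (2 * T) + 3 * (suc (2 * T) * (4 * (T * suc T))) ≤ 3 * symSum T (λ a → 2 * doubledDistSum T a) ×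
    3 * symSum T (λ a → 2 * doubledDistSum T a) ≤ T * suc T * suc (2 * T) + 3 * (suc (2 * T) * (4 * (T * suc T) + 1))
  3*symSum-doubledDistSum-bounds T = lower , upper
    where
    open ≤-Reasoning
    lower = begin
      T * suc T * suc (2 * T) + 3 * (suc (2 * T) * (4 * (T * suc T)))  ≡⟨ symSum-squares+const T _ ⟨
      3 * symSum T (λ c → ∣ c ∣ * ∣ c ∣ + 4 * (T * suc T))
        ≤⟨ *-monoʳ-≤ 3 (symSum-mono T λ c c≤T → proj₁ (doubledDistSum-bounds T c c≤T)) ⟩
      3 * symSum T (λ a → 2 * doubledDistSum T a)                      ∎
    upper = begin
      3 * symSum T (λ a → 2 * doubledDistSum T a)
        ≤⟨ *-monoʳ-≤ 3 (symSum-mono T λ c c≤T → proj₂ (doubledDistSum-bounds T c c≤T)) ⟩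
      3 * symSum T (λ c → ∣ c ∣ * ∣ c ∣ + (4 * (T * suc T) + 1))            ≡⟨ symSum-squares+const T _ ⟩
      T * suc T * suc (2 * T) + 3 * (suc (2 * T) * (4 * (T * suc T) + 1))  ∎

  Σ²hexNorm₀-bounds : ∀ T → 17 * (T * suc T * suc (2 * T)) ≤ 3 * Σ² T hexNorm₀ ×
                             3 * Σ² T hexNorm₀ ≤ 17 * (T * suc T * suc (2 * T)) + 3 * suc (2 * T)
  Σ²hexNorm₀-bounds T = lower , upper
    where
    open ≤-Reasoning
    X = T * suc T * suc (2 * T)
    Φ = 3 * symSum T (distSum T)
    Ψ = 3 * symSum T (λ a → 2 * doubledDistSum T a)
    split : 3 * Σ² T hexNorm₀ ≡ Φ + Ψ
    split = trans (cong (3 *_) (Σ²hexNorm₀ T))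
                  (*-distribˡ-+ 3 (symSum T (distSum T)) (symSum T (λ a → 2 * doubledDistSum T a)))
    lower : 17 * X ≤ 3 * Σ² T hexNorm₀
    lower = begin
      17 * X                                                                            ≡⟨ count T ⟩
      X + 3 * (suc (2 * T) * (T * suc T)) + (X + 3 * (suc (2 * T) * (4 * (T * suc T))))
        ≤⟨ +-mono-≤ (≤-reflexive (sym (3*symSum-distSum T))) (proj₁ (3*symSum-doubledDistSum-bounds T)) ⟩
      Φ + Ψ                                                                             ≡⟨ split ⟨
      3 * Σ² T hexNorm₀                                                                 ∎
      where count : ∀ T → 17 * (T * (1 + T) * (1 + 2 * T))
                          ≡ T * (1 + T) * (1 + 2 * T) + 3 * ((1 + 2 * T) * (T * (1 + T)))
                            + (T * (1 + T) * (1 + 2 * T) + 3 * ((1 + 2 * T) * (4 * (T * (1 + T)))))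
            count = solve-∀
    upper : 3 * Σ² T hexNorm₀ ≤ 17 * X + 3 * suc (2 * T)
    upper = begin
      3 * Σ² T hexNorm₀                                                                     ≡⟨ split ⟩
      Φ + Ψ
        ≤⟨ +-mono-≤ (≤-reflexive (3*symSum-distSum T)) (proj₂ (3*symSum-doubledDistSum-bounds T)) ⟩
      X + 3 * (suc (2 * T) * (T * suc T)) + (X + 3 * (suc (2 * T) * (4 * (T * suc T) + 1))) ≡⟨ count T ⟩
      17 * X + 3 * suc (2 * T)                                                              ∎
      where count : ∀ T → T * (1 + T) * (1 + 2 * T) + 3 * ((1 + 2 * T) * (T * (1 + T)))
                            + (T * (1 + T) * (1 + 2 * T) + 3 * ((1 + 2 * T) * (4 * (T * (1 + T)) + 1)))
                          ≡ 17 * (T * (1 + T) * (1 + 2 * T)) + 3 * (1 + 2 * T)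
            count = solve-∀

open LatticeSums

module HexagonalNorm where
  open import Data.Nat using (zero; suc; _+_; _*_)
  open import Data.Nat.Properties
  open import Data.Nat.Tactic.RingSolver using (solve-∀)
  import Data.Integer as ℤ
  import Data.Integer.Properties as ℤP
  import Data.Integer.Tactic.RingSolver as ℤ-Solver
  open import Data.Integer using (∣_∣)

  ∣∣-neg : ∀ {i j} → i ≡ ℤ.- j → ∣ i ∣ ≡ ∣ j ∣
  ∣∣-neg {j = j} e = trans (cong ∣_∣ e) (ℤP.∣-i∣≡∣i∣ j)

  ∣∣-close : ∀ {x} y d → x ≡ y ℤ.+ d → ∣ x ∣ ≤ ∣ y ∣ + ∣ d ∣ × ∣ y ∣ ≤ ∣ x ∣ + ∣ d ∣
  ∣∣-close y d refl = ℤP.∣i+j∣≤∣i∣+∣j∣ y d , (begin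
    ∣ y ∣                         ≡⟨ cong ∣_∣ (cancel y d) ⟩
    ∣ y ℤ.+ d ℤ.+ ℤ.- d ∣         ≤⟨ ℤP.∣i+j∣≤∣i∣+∣j∣ (y ℤ.+ d) (ℤ.- d) ⟩
    ∣ y ℤ.+ d ∣ + ∣ ℤ.- d ∣       ≡⟨ cong (λ t → ∣ y ℤ.+ d ∣ + t) (ℤP.∣-i∣≡∣i∣ d) ⟩
    ∣ y ℤ.+ d ∣ + ∣ d ∣           ∎)
    where open ≤-Reasoning
          cancel : ∀ y d → y ≡ y ℤ.+ d ℤ.+ ℤ.- d
          cancel = ℤ-Solver.solve-∀

  hexNorm : Point → ℕ
  hexNorm p = ∣ ℓ₁ p ∣ + ∣ ℓ₂ p ∣ + ∣ ℓ₃ p ∣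

  hexNorm-K′ : ∀ p → hexNorm (K′ p) ≡ hexNorm p
  hexNorm-K′ p = trans (cong₂ _+_ (cong₂ _+_ (∣∣-neg (ℓ₁-K′ p)) (∣∣-neg (ℓ₂-K′ p))) (∣∣-neg (ℓ₃-K′ p)))
                       (cong (_+ ∣ ℓ₃ p ∣) (+-comm (∣ ℓ₂ p ∣) (∣ ℓ₁ p ∣)))

  hexNorm-K″ : ∀ p → hexNorm (K″ p) ≡ hexNorm p
  hexNorm-K″ p = trans (cong₂ _+_ (cong₂ _+_ (cong ∣_∣ (ℓ₁-K″ p)) (∣∣-neg (ℓ₂-K″ p))) (cong ∣_∣ (ℓ₃-K″ p)))
                       (reverse (∣ ℓ₁ p ∣) (∣ ℓ₂ p ∣) (∣ ℓ₃ p ∣))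
    where reverse : ∀ a b c → c + b + a ≡ a + b + c
          reverse = solve-∀

  hexNorm-Reach : ∀ {p q} → Reach p q → hexNorm q ≡ hexNorm p
  hexNorm-Reach here           = refl
  hexNorm-Reach (stepK′ {q} h) = trans (hexNorm-K′ q) (hexNorm-Reach h)
  hexNorm-Reach (stepK″ {q} h) = trans (hexNorm-K″ q) (hexNorm-Reach h)

  sqDist : Point → Point → ℕ
  sqDist (x₁ , y₁) (x₂ , y₂) = ∣ x₁ ℤ.- x₂ ∣ * ∣ x₁ ℤ.- x₂ ∣ + ∣ y₁ ℤ.- y₂ ∣ * ∣ y₁ ℤ.- y₂ ∣

  sqDist-K′ : ∀ q → sqDist q (K′ q) ≡ ∣ ℓ₃ q ∣ * ∣ ℓ₃ q ∣
  sqDist-K′ (x , y) =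
    trans (cong₂ (λ s t → ∣ s ∣ * ∣ s ∣ + ∣ t ∣ * ∣ t ∣) (horizontal x y) (ℤP.+-inverseʳ y)) (+-identityʳ _)
    where horizontal : ∀ x y → x ℤ.- (ℤ.- x ℤ.+ y ℤ.+ + 1) ≡ + 2 ℤ.* x ℤ.- y ℤ.- + 1
          horizontal = ℤ-Solver.solve-∀

  sqDist-K″ : ∀ q → sqDist q (K″ q) ≡ ∣ ℓ₂ q ∣ * ∣ ℓ₂ q ∣
  sqDist-K″ (x , y) = cong₂ (λ s t → ∣ s ∣ * ∣ s ∣ + t * t) (ℤP.+-inverseʳ x) (∣∣-neg (vertical x y))
    where vertical : ∀ x y → y ℤ.- (x ℤ.- y ℤ.+ + 1) ≡ ℤ.- (x ℤ.- + 2 ℤ.* y ℤ.+ + 1)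
          vertical = ℤ-Solver.solve-∀

  side : Point → Fin 6 → ℕ
  side p zero                                = ∣ ℓ₁ p ∣
  side p (suc zero)                          = ∣ ℓ₂ p ∣
  side p (suc (suc zero))                    = ∣ ℓ₃ p ∣
  side p (suc (suc (suc zero)))              = ∣ ℓ₁ p ∣
  side p (suc (suc (suc (suc zero))))        = ∣ ℓ₂ p ∣
  side p (suc (suc (suc (suc (suc zero))))) = ∣ ℓ₃ p ∣

  square-cong : ∀ {m n} → m ≡ n → m * m ≡ n * n
  square-cong = cong (λ n → n * n)

  segSq≡side² : ∀ p i → segSq p i ≡ side p i * side p i
  segSq≡side² p zero = trans (sqDist-K″ (K′ p)) (square-cong (∣∣-neg (ℓ₂-K′ p)))
  segSq≡side² p (suc zero) = trans (sqDist-K′ (rotate p)) (square-cong (∣∣-neg (ℓ₃-rotate p)))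
  segSq≡side² p (suc (suc zero)) = trans (sqDist-K″ (K′ (rotate p)))
    (square-cong (trans (∣∣-neg (ℓ₂-K′ (rotate p))) (∣∣-neg (ℓ₁-rotate p))))
  segSq≡side² p (suc (suc (suc zero))) = trans (sqDist-K′ (rotate (rotate p)))
    (square-cong (trans (∣∣-neg (ℓ₃-rotate (rotate p))) (cong ∣_∣ (ℓ₂-rotate p))))
  segSq≡side² p (suc (suc (suc (suc zero)))) = trans (sqDist-K″ (K′ (rotate (rotate p))))
    (square-cong (trans (∣∣-neg (ℓ₂-K′ (rotate (rotate p))))
                        (trans (∣∣-neg (ℓ₁-rotate (rotate p))) (∣∣-neg (ℓ₃-rotate p)))))
  segSq≡side² p (suc (suc (suc (suc (suc zero))))) =
    trans (cong (λ t → sqDist t (K′ p)) (rotate³≡id p)) (sqDist-K′ p)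

  perimeter : ∀ p → side p zero + side p (suc zero) + side p (suc (suc zero)) + side p (suc (suc (suc zero)))
                    + side p (suc (suc (suc (suc zero)))) + side p (suc (suc (suc (suc (suc zero)))))
                    ≡ 2 * hexNorm p
  perimeter p = twice (∣ ℓ₁ p ∣) (∣ ℓ₂ p ∣) (∣ ℓ₃ p ∣)
    where twice : ∀ a b c → a + b + c + a + b + c ≡ 2 * (a + b + c)
          twice = solve-∀

  -- hexNorm₀ a b = hexNorm (a + 1 , b + 1): the two differ only through the constants in the ℓᵢ.
  hexNorm≈hexNorm₀ : ∀ a b → hexNorm (a , b) ≤ hexNorm₀ a b + 4 × hexNorm₀ a b ≤ hexNorm (a , b) + 4
  hexNorm≈hexNorm₀ a b =
    add (proj₁ close₁) (proj₁ close₂) (proj₁ close₃) , add (proj₂ close₁) (proj₂ close₂) (proj₂ close₃)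
    where
    close₁ : ∣ ℓ₁ (a , b) ∣ ≤ ∣ b ℤ.+ a ∣ + 2 × ∣ b ℤ.+ a ∣ ≤ ∣ ℓ₁ (a , b) ∣ + 2
    close₁ = ∣∣-close (b ℤ.+ a) (ℤ.- + 2) (shift a b)
      where shift : ∀ a b → a ℤ.+ b ℤ.- + 2 ≡ b ℤ.+ a ℤ.+ ℤ.- + 2
            shift = ℤ-Solver.solve-∀
    close₂ : ∣ ℓ₂ (a , b) ∣ ≤ ∣ b ℤ.+ b ℤ.- a ∣ + 1 × ∣ b ℤ.+ b ℤ.- a ∣ ≤ ∣ ℓ₂ (a , b) ∣ + 1
    close₂ = subst (λ t → t ≤ ∣ b ℤ.+ b ℤ.- a ∣ + 1 × ∣ b ℤ.+ b ℤ.- a ∣ ≤ t + 1) (ℤP.∣-i∣≡∣i∣ (ℓ₂ (a , b)))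
                   (∣∣-close (b ℤ.+ b ℤ.- a) (ℤ.- + 1) (shift a b))
      where shift : ∀ a b → ℤ.- (a ℤ.- + 2 ℤ.* b ℤ.+ + 1) ≡ b ℤ.+ b ℤ.- a ℤ.+ ℤ.- + 1
            shift = ℤ-Solver.solve-∀
    close₃ : ∣ ℓ₃ (a , b) ∣ ≤ ∣ a ℤ.+ a ℤ.- b ∣ + 1 × ∣ a ℤ.+ a ℤ.- b ∣ ≤ ∣ ℓ₃ (a , b) ∣ + 1
    close₃ = ∣∣-close (a ℤ.+ a ℤ.- b) (ℤ.- + 1) (shift a b)
      where shift : ∀ a b → + 2 ℤ.* a ℤ.- b ℤ.- + 1 ≡ a ℤ.+ a ℤ.- b ℤ.+ ℤ.- + 1
            shift = ℤ-Solver.solve-∀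
    add : ∀ {x₁ x₂ x₃ y₁ y₂ y₃} → x₁ ≤ y₁ + 2 → x₂ ≤ y₂ + 1 → x₃ ≤ y₃ + 1 → x₁ + x₂ + x₃ ≤ y₁ + y₂ + y₃ + 4
    add {y₁ = y₁} {y₂} {y₃} h₁ h₂ h₃ = ≤-trans (+-mono-≤ (+-mono-≤ h₁ h₂) h₃) (≤-reflexive (collect y₁ y₂ y₃))
      where collect : ∀ y₁ y₂ y₃ → y₁ + 2 + (y₂ + 1) + (y₃ + 1) ≡ y₁ + y₂ + y₃ + 4
            collect = solve-∀

  totalHexNorm : ℕ → ℕ
  totalHexNorm T = Σ² T (λ a b → hexNorm (a , b))

  totalHexNorm≈ : ∀ T → totalHexNorm T ≤ Σ² T hexNorm₀ + suc (2 * T) * suc (2 * T) * 4 ×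
                         Σ² T hexNorm₀ ≤ totalHexNorm T + suc (2 * T) * suc (2 * T) * 4
  totalHexNorm≈ T =
    ≤-trans (Σ²-mono T λ a b → proj₁ (hexNorm≈hexNorm₀ a b))
            (≤-reflexive (trans (Σ²-+ T _ _) (cong (λ t → Σ² T hexNorm₀ + t) (Σ²-const T 4)))) ,
    ≤-trans (Σ²-mono T λ a b → proj₂ (hexNorm≈hexNorm₀ a b))
            (≤-reflexive (trans (Σ²-+ T _ _) (cong (λ t → totalHexNorm T + t) (Σ²-const T 4))))

  totalLength : ℕ → ℕ
  totalLength T = 2 * totalHexNorm T

  sum-grid-perimeters : ∀ T → sum (map (λ p → 2 * hexNorm p) (grid T)) ≡ totalLength T
  sum-grid-perimeters T = trans (sum-grid T (λ p → 2 * hexNorm p)) (Σ²-*ˡ T 2 (λ a b → hexNorm (a , b)))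

  totalLength-upper : ∀ T → 3 * totalLength T ≤ (17 * T + 3 * 11) * (suc (2 * T) * suc (2 * T))
  totalLength-upper T = begin
    3 * (2 * totalHexNorm T)                               ≡⟨ swap 3 2 (totalHexNorm T) ⟩
    2 * (3 * totalHexNorm T)                               ≤⟨ *-monoʳ-≤ 2 (*-monoʳ-≤ 3 (proj₁ (totalHexNorm≈ T))) ⟩
    2 * (3 * (M + N * 4))                                  ≡⟨ cong (2 *_) (*-distribˡ-+ 3 M (N * 4)) ⟩
    2 * (3 * M + 3 * (N * 4))
      ≤⟨ *-monoʳ-≤ 2 (+-monoˡ-≤ (3 * (N * 4)) (proj₂ (Σ²hexNorm₀-bounds T))) ⟩
    2 * (17 * X + 3 * suc (2 * T) + 3 * (N * 4))           ≤⟨ m≤m+n _ ((T + 3) * suc (2 * T)) ⟩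
    2 * (17 * X + 3 * suc (2 * T) + 3 * (N * 4)) + (T + 3) * suc (2 * T)
                                                           ≡⟨ count T ⟩
    (17 * T + 3 * 11) * N                                  ∎
    where
    open ≤-Reasoning
    M = Σ² T hexNorm₀
    N = suc (2 * T) * suc (2 * T)
    X = T * suc T * suc (2 * T)
    swap : ∀ a b c → a * (b * c) ≡ b * (a * c)
    swap = solve-∀
    count : ∀ T → 2 * (17 * (T * (1 + T) * (1 + 2 * T)) + 3 * (1 + 2 * T) + 3 * ((1 + 2 * T) * (1 + 2 * T) * 4))
                    + (T + 3) * (1 + 2 * T)
                  ≡ (17 * T + 3 * 11) * ((1 + 2 * T) * (1 + 2 * T))
    count = solve-∀

  totalLength-lower : ∀ T → 17 * T * (suc (2 * T) * suc (2 * T))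
                            ≤ 3 * totalLength T + 3 * 11 * (suc (2 * T) * suc (2 * T))
  totalLength-lower T = begin
    17 * T * N                                   ≤⟨ m≤m+n (17 * T * N) (17 * T * suc (2 * T)) ⟩
    17 * T * N + 17 * T * suc (2 * T)            ≡⟨ count T ⟩
    2 * (17 * (T * suc T * suc (2 * T)))         ≤⟨ *-monoʳ-≤ 2 (proj₁ (Σ²hexNorm₀-bounds T)) ⟩
    2 * (3 * Σ² T hexNorm₀)                      ≤⟨ *-monoʳ-≤ 2 (*-monoʳ-≤ 3 (proj₂ (totalHexNorm≈ T))) ⟩
    2 * (3 * (totalHexNorm T + N * 4))           ≡⟨ regroup (totalHexNorm T) N ⟩
    3 * (2 * totalHexNorm T) + 3 * 8 * N
      ≤⟨ +-monoʳ-≤ (3 * (2 * totalHexNorm T)) (*-monoˡ-≤ N (*-monoʳ-≤ 3 (m≤m+n 8 3))) ⟩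
    3 * (2 * totalHexNorm T) + 3 * 11 * N        ∎
    where
    open ≤-Reasoning
    N = suc (2 * T) * suc (2 * T)
    count : ∀ T → 17 * T * ((1 + 2 * T) * (1 + 2 * T)) + 17 * T * (1 + 2 * T) ≡ 2 * (17 * (T * (1 + T) * (1 + 2 * T)))
    count = solve-∀
    regroup : ∀ H N → 2 * (3 * (H + N * 4)) ≡ 3 * (2 * H) + 3 * 8 * N
    regroup = solve-∀

open HexagonalNorm

module FreshCycles where
  open import Data.Nat using (zero; suc; _+_; _*_; _<_; s≤s; z≤n)
  open import Data.Nat.Properties
  open import Data.Nat.Tactic.RingSolver using (solve-∀)
  import Data.Integer as ℤ
  import Data.Integer.Properties as ℤP
  import Data.Integer.Tactic.RingSolver as ℤ-Solver
  open import Data.Integer using (∣_∣)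
  open import Data.List.Relation.Unary.All using ([]; _∷_)

  fresh : ∀ L {p} → sum (map hexNorm L) < hexNorm p → All (λ q → ¬ SameCycle q p) L
  fresh []      _ = []
  fresh (q ∷ L) {p} bound =
    (λ same → <-irrefl (sym (hexNorm-Reach (proj₂ (same p) here))) (≤-<-trans (m≤m+n (hexNorm q) _) bound))
    ∷ fresh L (≤-<-trans (m≤n+m _ (hexNorm q)) bound)

  3x≤hexNorm+3 : ∀ u y → 3 * u ≤ hexNorm (+ u , y) + 3
  3x≤hexNorm+3 u y = begin
    3 * u                ≤⟨ proj₁ (∣∣-close (l₁ ℤ.+ l₃) (+ 3) (trans (ℤP.pos-* 3 u) (thrice (+ u) y))) ⟩
    ∣ l₁ ℤ.+ l₃ ∣ + 3    ≤⟨ +-monoˡ-≤ 3 (ℤP.∣i+j∣≤∣i∣+∣j∣ l₁ l₃) ⟩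
    ∣ l₁ ∣ + ∣ l₃ ∣ + 3  ≤⟨ +-monoˡ-≤ 3 (+-monoˡ-≤ (∣ l₃ ∣) (m≤m+n (∣ l₁ ∣) (∣ ℓ₂ (+ u , y) ∣))) ⟩
    hexNorm (+ u , y) + 3  ∎
    where
    open ≤-Reasoning
    l₁ = ℓ₁ (+ u , y)
    l₃ = ℓ₃ (+ u , y)
    thrice : ∀ x y → + 3 ℤ.* x ≡ (x ℤ.+ y ℤ.- + 2) ℤ.+ (+ 2 ℤ.* x ℤ.- y ℤ.- + 1) ℤ.+ + 3
    thrice = ℤ-Solver.solve-∀

  below-hexNorm : ∀ {B u h} → B + 2 ≤ u → 3 * u ≤ h + 3 → B < h
  below-hexNorm {B} {u} {h} B+2≤u 3u≤h+3 = begin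
    suc B                ≤⟨ m≤m+n (suc B) (B + B + 2) ⟩
    suc B + (B + B + 2)  ≡⟨ regroup B ⟩
    3 * B + 3            ≤⟨ +-cancelʳ-≤ 3 (3 * B + 3) h (begin
                              3 * B + 3 + 3  ≡⟨ regroup′ B ⟩
                              3 * (B + 2)    ≤⟨ *-monoʳ-≤ 3 B+2≤u ⟩
                              3 * u          ≤⟨ 3u≤h+3 ⟩
                              h + 3          ∎) ⟩
    h                    ∎
    where
    open ≤-Reasoning
    regroup : ∀ B → suc B + (B + B + 2) ≡ 3 * B + 3
    regroup = solve-∀
    regroup′ : ∀ B → 3 * B + 3 + 3 ≡ 3 * (B + 2)
    regroup′ = solve-∀

  K″-coordinate : ∀ {u v w} → u + 1 ≡ v + w → ∣ + u ℤ.- + v ℤ.+ + 1 ∣ ≡ w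
  K″-coordinate {u} {v} {w} u+1≡v+w = cong ∣_∣ (begin
    + u ℤ.- + v ℤ.+ + 1  ≡⟨ swap (+ u) (+ v) ⟩
    + (u + 1) ℤ.- + v    ≡⟨ cong (λ t → + t ℤ.- + v) u+1≡v+w ⟩
    + v ℤ.+ + w ℤ.- + v  ≡⟨ cancel (+ v) (+ w) ⟩
    + w                  ∎)
    where
    open ≡-Reasoning
    swap : ∀ u v → u ℤ.- v ℤ.+ + 1 ≡ u ℤ.+ + 1 ℤ.- v
    swap = ℤ-Solver.solve-∀
    cancel : ∀ v w → v ℤ.+ w ℤ.- v ≡ w
    cancel = ℤ-Solver.solve-∀

  freshTriple : ∀ {P : ℕ → Set} L {u v w} → u + 1 ≡ v + w → w < v → v < u → P u → P v → P w →
                sum (map hexNorm L) + 2 ≤ u →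
                Σ Point (λ p → HasThreeDistinct P p × All (λ q → ¬ SameCycle q p) L)
  freshTriple L {u} {v} {w} u+1≡v+w w<v v<u Pu Pv Pw large =
    (+ u , + v) ,
    (u , v , w ,
     (λ u≡v → <⇒≢ v<u (sym u≡v)) , (λ u≡w → <⇒≢ (<-trans w<v v<u) (sym u≡w)) , (λ v≡w → <⇒≢ w<v (sym v≡w)) ,
     (((+ u , + v) , here , inj₁ refl) , Pu) ,
     (((+ u , + v) , here , inj₂ refl) , Pv) ,
     ((K″ (+ u , + v) , stepK″ here , inj₂ (sym (K″-coordinate u+1≡v+w))) , Pw)) ,
    fresh L (below-hexNorm large (3x≤hexNorm+3 u (+ v)))

  n≤n*n : ∀ n → n ≤ n * n
  n≤n*n zero    = z≤n
  n≤n*n (suc n) = m≤m*n (suc n) (suc n)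

  n≤n*n*n : ∀ n → n ≤ n * n * n
  n≤n*n*n zero    = z≤n
  n≤n*n*n (suc n) = ≤-trans (n≤n*n (suc n)) (m≤m*n (suc n * suc n) (suc n))

  <-witness : ∀ m d {n} → n ≡ suc (m + d) → m < n
  <-witness m d refl = s≤s (m≤m+n m d)

  ≤-witness : ∀ m d {n} → n ≡ m + d → m ≤ n
  ≤-witness m d refl = m≤m+n m d

  squareCycles : (L : List Point) → Σ Point (λ p → HasThreeDistinct IsSquare p × All (λ q → ¬ SameCycle q p) L)
  squareCycles L =
    freshTriple L (identity k) (*-mono-< y<z y<z) (*-mono-< z<x z<x) (x , refl) (z , refl) (y , refl)
                (≤-trans (≤-witness (k + 2) (k * k + 6 * k + 11) (spread k)) (n≤n*n x))
    where
    k = sum (map hexNorm L)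
    x = k * k + 7 * k + 13
    z = k * k + 7 * k + 11
    y = 2 * k + 7
    identity : ∀ k → (k * k + 7 * k + 13) * (k * k + 7 * k + 13) + 1
                     ≡ (k * k + 7 * k + 11) * (k * k + 7 * k + 11) + (2 * k + 7) * (2 * k + 7)
    identity = solve-∀
    y<z : y < z
    y<z = <-witness y (k * k + 5 * k + 3) (gap k)
      where gap : ∀ k → k * k + 7 * k + 11 ≡ suc (2 * k + 7 + (k * k + 5 * k + 3))
            gap = solve-∀
    z<x : z < x
    z<x = <-witness z 1 (gap k)
      where gap : ∀ k → k * k + 7 * k + 13 ≡ suc (k * k + 7 * k + 11 + 1)
            gap = solve-∀
    spread : ∀ k → k * k + 7 * k + 13 ≡ k + 2 + (k * k + 6 * k + 11)
    spread = solve-∀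

  cubeCycles : (L : List Point) → Σ Point (λ p → HasThreeDistinct IsCube p × All (λ q → ¬ SameCycle q p) L)
  cubeCycles L =
    freshTriple L (identity t) (cube-< c<b) (cube-< b<a) (a , refl) (b , refl) (c , refl)
                (≤-trans (≤-witness (k + 2) (9 * t⁴ + 2 * t) (spread k)) (n≤n*n*n a))
    where
    k = sum (map hexNorm L)
    t = 2 + k
    t⁴ = t * t * t * t
    a = 9 * t⁴ + 3 * t
    b = 9 * t⁴
    c = 9 * (t * t * t) + 1
    cube-< : ∀ {m n} → m < n → m * m * m < n * n * n
    cube-< m<n = *-mono-< (*-mono-< m<n m<n) m<n
    identity : ∀ t → let a = 9 * (t * t * t * t) + 3 * t ; b = 9 * (t * t * t * t) ; c = 9 * (t * t * t) + 1
                     in a * a * a + 1 ≡ b * b * b + c * c * c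
    identity = solve-∀
    c<b : c < b
    c<b = <-witness c (9 * (k * k * k * k) + 63 * (k * k * k) + 162 * (k * k) + 180 * k + 70) (gap k)
      where gap : ∀ k → 9 * ((2 + k) * (2 + k) * (2 + k) * (2 + k))
                        ≡ suc (9 * ((2 + k) * (2 + k) * (2 + k)) + 1
                               + (9 * (k * k * k * k) + 63 * (k * k * k) + 162 * (k * k) + 180 * k + 70))
            gap = solve-∀
    b<a : b < a
    b<a = <-witness b (3 * k + 5) (gap k)
      where gap : ∀ k → 9 * ((2 + k) * (2 + k) * (2 + k) * (2 + k)) + 3 * (2 + k)
                        ≡ suc (9 * ((2 + k) * (2 + k) * (2 + k) * (2 + k)) + (3 * k + 5))
            gap = solve-∀
    spread : ∀ k → 9 * ((2 + k) * (2 + k) * (2 + k) * (2 + k)) + 3 * (2 + k)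
                   ≡ k + 2 + (9 * ((2 + k) * (2 + k) * (2 + k) * (2 + k)) + 2 * (2 + k))
    spread = solve-∀

open FreshCycles

module AverageLength where
  open import Data.Nat using (zero; suc; _+_; _*_; z≤n)
  import Data.Integer as ℤ
  import Data.Integer.Properties as ℤP
  import Data.Integer.Tactic.RingSolver as ℤ-Solver
  open import Data.Rational using (0ℚ; _/_; toℚᵘ; _-_; nonNegative; positive)
    renaming (_+_ to _+ℚ_; _*_ to _*ℚ_; -_ to -ℚ_; _≤_ to _≤ℚ_)
  import Data.Rational.Properties as ℚ
  open import Data.Rational.Unnormalised using (mkℚᵘ; *≡*; *≤*)
    renaming (_≃_ to _≃ᵘ_; _≤_ to _≤ᵘ_; _+_ to _+ᵘ_; _*_ to _*ᵘ_; -_ to -ᵘ_)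
  import Data.Rational.Unnormalised.Properties as ℚᵘ

  -- Written as in Defs, so that gridSize T and (+ segSq p i) / 1 are values of ι by definition.
  ι : ℕ → ℚ
  ι n = + n / 1

  toℚᵘ-ι : ∀ n → toℚᵘ (ι n) ≃ᵘ mkℚᵘ (+ n) 0
  toℚᵘ-ι n = ℚ.toℚᵘ-fromℚᵘ (mkℚᵘ (+ n) 0)

  ≤-via-ℚᵘ : ∀ {p q p′ q′} → toℚᵘ p ≃ᵘ p′ → toℚᵘ q ≃ᵘ q′ → p′ ≤ᵘ q′ → p ≤ℚ q
  ≤-via-ℚᵘ p≃ q≃ p′≤q′ =
    ℚ.toℚᵘ-cancel-≤ (ℚᵘ.≤-respˡ-≃ (ℚᵘ.≃-sym p≃) (ℚᵘ.≤-respʳ-≃ (ℚᵘ.≃-sym q≃) p′≤q′))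

  ι-+ : ∀ m n → ι (m + n) ≡ ι m +ℚ ι n
  ι-+ m n = ℚ.toℚᵘ-injective (ℚᵘ.≃-trans (toℚᵘ-ι (m + n)) (ℚᵘ.≃-sym (begin
    toℚᵘ (ι m +ℚ ι n)              ≈⟨ ℚ.toℚᵘ-homo-+ (ι m) (ι n) ⟩
    toℚᵘ (ι m) +ᵘ toℚᵘ (ι n)       ≈⟨ ℚᵘ.+-cong (toℚᵘ-ι m) (toℚᵘ-ι n) ⟩
    mkℚᵘ (+ m) 0 +ᵘ mkℚᵘ (+ n) 0   ≈⟨ *≡* (identity (+ m) (+ n)) ⟩
    mkℚᵘ (+ (m + n)) 0             ∎)))
    where
    open ℚᵘ.≃-Reasoning
    identity : ∀ m n → (m ℤ.* + 1 ℤ.+ n ℤ.* + 1) ℤ.* + 1 ≡ (m ℤ.+ n) ℤ.* (+ 1 ℤ.* + 1)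
    identity = ℤ-Solver.solve-∀

  ι-* : ∀ m n → ι (m * n) ≡ ι m *ℚ ι n
  ι-* m n = ℚ.toℚᵘ-injective (ℚᵘ.≃-trans (toℚᵘ-ι (m * n)) (ℚᵘ.≃-sym (begin
    toℚᵘ (ι m *ℚ ι n)              ≈⟨ ℚ.toℚᵘ-homo-* (ι m) (ι n) ⟩
    toℚᵘ (ι m) *ᵘ toℚᵘ (ι n)       ≈⟨ ℚᵘ.*-cong (toℚᵘ-ι m) (toℚᵘ-ι n) ⟩
    mkℚᵘ (+ m) 0 *ᵘ mkℚᵘ (+ n) 0   ≈⟨ *≡* (cong (ℤ._* + 1) (sym (ℤP.pos-* m n))) ⟩
    mkℚᵘ (+ (m * n)) 0             ∎)))
    where open ℚᵘ.≃-Reasoning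

  ι-mono : ∀ {m n} → m ≤ n → ι m ≤ℚ ι n
  ι-mono {m} {n} m≤n = ≤-via-ℚᵘ (toℚᵘ-ι m) (toℚᵘ-ι n) (*≤* (ℤP.*-monoʳ-≤-nonNeg (+ 1) (ℤ.+≤+ m≤n)))

  ι-nonNeg : ∀ n → 0ℚ ≤ℚ ι n
  ι-nonNeg n = ι-mono {0} {n} z≤n

  square-≤⇒≤ : ∀ {p q} → 0ℚ ≤ℚ q → p *ℚ p ≤ℚ q *ℚ q → p ≤ℚ q
  square-≤⇒≤ {p} {q} 0≤q p²≤q² = ℚ.≮⇒≥ λ q<p →
    ℚ.<-irrefl refl (ℚ.≤-<-trans p²≤q² (ℚ.≤-<-trans
      (ℚ.*-monoʳ-≤-nonNeg q {{nonNegative 0≤q}} (ℚ.<⇒≤ q<p))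
      (ℚ.*-monoʳ-<-pos p {{positive (ℚ.≤-<-trans 0≤q q<p)}} q<p)))

  ι-≤-affine : ∀ L a C N → 3 * L ≤ (a + 3 * C) * N → ι L ≤ℚ ((+ a) / 3 +ℚ ι C) *ℚ ι N
  ι-≤-affine L a C N 3L≤ = ≤-via-ℚᵘ (toℚᵘ-ι L) rhs≃ (*≤* cross-multiplied)
    where
    rhs≃ : toℚᵘ (((+ a) / 3 +ℚ ι C) *ℚ ι N) ≃ᵘ (mkℚᵘ (+ a) 2 +ᵘ mkℚᵘ (+ C) 0) *ᵘ mkℚᵘ (+ N) 0
    rhs≃ = ℚᵘ.≃-trans (ℚ.toℚᵘ-homo-* ((+ a) / 3 +ℚ ι C) (ι N))
             (ℚᵘ.*-cong (ℚᵘ.≃-trans (ℚ.toℚᵘ-homo-+ ((+ a) / 3) (ι C))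
                                    (ℚᵘ.+-cong (ℚ.toℚᵘ-fromℚᵘ (mkℚᵘ (+ a) 2)) (toℚᵘ-ι C)))
                        (toℚᵘ-ι N))
    cross-multiplied : + L ℤ.* + 3 ℤ.≤ ((+ a ℤ.* + 1 ℤ.+ + C ℤ.* + 3) ℤ.* + N) ℤ.* + 1
    cross-multiplied = begin
      + L ℤ.* + 3                                      ≡⟨ trans (ℤP.*-comm (+ L) (+ 3)) (sym (ℤP.pos-* 3 L)) ⟩
      + (3 * L)                                        ≤⟨ ℤ.+≤+ 3L≤ ⟩
      + ((a + 3 * C) * N)                              ≡⟨ cast ⟩
      (+ a ℤ.+ + 3 ℤ.* + C) ℤ.* + N                    ≡⟨ regroup (+ a) (+ C) (+ N) ⟩
      ((+ a ℤ.* + 1 ℤ.+ + C ℤ.* + 3) ℤ.* + N) ℤ.* + 1  ∎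
      where
      open ℤP.≤-Reasoning
      cast = trans (ℤP.pos-* (a + 3 * C) N)
                   (cong (ℤ._* + N) (trans (ℤP.pos-+ a (3 * C)) (cong (λ t → + a ℤ.+ t) (ℤP.pos-* 3 C))))
      regroup : ∀ a C N → (a ℤ.+ + 3 ℤ.* C) ℤ.* N ≡ ((a ℤ.* + 1 ℤ.+ C ℤ.* + 3) ℤ.* N) ℤ.* + 1
      regroup = ℤ-Solver.solve-∀

  affine-≤-ι : ∀ L a C N → a * N ≤ 3 * L + 3 * C * N → ((+ a) / 3 - ι C) *ℚ ι N ≤ℚ ι L
  affine-≤-ι L a C N aN≤ = ≤-via-ℚᵘ lhs≃ (toℚᵘ-ι L) (*≤* cross-multiplied)
    where
    lhs≃ : toℚᵘ (((+ a) / 3 - ι C) *ℚ ι N) ≃ᵘ (mkℚᵘ (+ a) 2 +ᵘ -ᵘ mkℚᵘ (+ C) 0) *ᵘ mkℚᵘ (+ N) 0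
    lhs≃ = ℚᵘ.≃-trans (ℚ.toℚᵘ-homo-* ((+ a) / 3 - ι C) (ι N))
             (ℚᵘ.*-cong (ℚᵘ.≃-trans (ℚ.toℚᵘ-homo-+ ((+ a) / 3) (-ℚ ι C))
                                    (ℚᵘ.+-cong (ℚ.toℚᵘ-fromℚᵘ (mkℚᵘ (+ a) 2))
                                               (ℚᵘ.≃-trans (ℚ.toℚᵘ-homo‿- (ι C)) (ℚᵘ.-‿cong (toℚᵘ-ι C)))))
                        (toℚᵘ-ι N))
    3CN = + 3 ℤ.* + C ℤ.* + N
    cross-multiplied : ((+ a ℤ.* + 1 ℤ.+ ℤ.- + C ℤ.* + 3) ℤ.* + N) ℤ.* + 1 ℤ.≤ + L ℤ.* + 3
    cross-multiplied = begin
      ((+ a ℤ.* + 1 ℤ.+ ℤ.- + C ℤ.* + 3) ℤ.* + N) ℤ.* + 1  ≡⟨ regroup (+ a) (+ C) (+ N) ⟩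
      + a ℤ.* + N ℤ.- 3CN                                  ≡⟨ cong (ℤ._- 3CN) (sym (ℤP.pos-* a N)) ⟩
      + (a * N) ℤ.- 3CN                                    ≤⟨ ℤP.+-monoˡ-≤ (ℤ.- 3CN) (ℤ.+≤+ aN≤) ⟩
      + (3 * L + 3 * C * N) ℤ.- 3CN                        ≡⟨ cong (ℤ._- 3CN) cast ⟩
      + 3 ℤ.* + L ℤ.+ 3CN ℤ.- 3CN                          ≡⟨ cancel (+ L) 3CN ⟩
      + L ℤ.* + 3                                          ∎
      where
      open ℤP.≤-Reasoning
      cast = trans (ℤP.pos-+ (3 * L) (3 * C * N))
                   (cong₂ ℤ._+_ (ℤP.pos-* 3 L) (trans (ℤP.pos-* (3 * C) N) (cong (ℤ._* + N) (ℤP.pos-* 3 C))))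
      regroup : ∀ a C N → ((a ℤ.* + 1 ℤ.+ ℤ.- C ℤ.* + 3) ℤ.* N) ℤ.* + 1 ≡ a ℤ.* N ℤ.- + 3 ℤ.* C ℤ.* N
      regroup = ℤ-Solver.solve-∀
      cancel : ∀ L X → + 3 ℤ.* L ℤ.+ X ℤ.- X ≡ L ℤ.* + 3
      cancel = ℤ-Solver.solve-∀

  sumℚ-mono : ∀ {A : Set} (xs : List A) {f g : A → ℚ} → (∀ x → f x ≤ℚ g x) →
              sumℚ (map f xs) ≤ℚ sumℚ (map g xs)
  sumℚ-mono []       _   = ℚ.≤-refl
  sumℚ-mono (x ∷ xs) f≤g = ℚ.+-mono-≤ (f≤g x) (sumℚ-mono xs f≤g)

  sumℚ-ι : ∀ {A : Set} (xs : List A) (f : A → ℕ) → sumℚ (map (λ x → ι (f x)) xs) ≡ ι (sum (map f xs))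
  sumℚ-ι []       f = refl
  sumℚ-ι (x ∷ xs) f = trans (cong (ι (f x) +ℚ_) (sumℚ-ι xs f)) (sym (ι-+ (f x) _))

  sum6-mono : ∀ {f g : Fin 6 → ℚ} → (∀ i → f i ≤ℚ g i) → sum6 f ≤ℚ sum6 g
  sum6-mono f≤g =
    ℚ.+-mono-≤ (ℚ.+-mono-≤ (ℚ.+-mono-≤ (ℚ.+-mono-≤ (ℚ.+-mono-≤ (f≤g zero) (f≤g (suc zero)))
      (f≤g (suc (suc zero)))) (f≤g (suc (suc (suc zero))))) (f≤g (suc (suc (suc (suc zero))))))
      (f≤g (suc (suc (suc (suc (suc zero))))))

  sum6-ι : ∀ (s : Fin 6 → ℕ) →
           sum6 (λ i → ι (s i)) ≡ ι (s zero + s (suc zero) + s (suc (suc zero)) + s (suc (suc (suc zero)))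
                                     + s (suc (suc (suc (suc zero)))) + s (suc (suc (suc (suc (suc zero))))))
  sum6-ι s = sym (begin
    ι (s₀ + s₁ + s₂ + s₃ + s₄ + s₅)               ≡⟨ ι-+ (s₀ + s₁ + s₂ + s₃ + s₄) s₅ ⟩
    ι (s₀ + s₁ + s₂ + s₃ + s₄) +ℚ ι s₅            ≡⟨ cong (_+ℚ ι s₅) (ι-+ (s₀ + s₁ + s₂ + s₃) s₄) ⟩
    ι (s₀ + s₁ + s₂ + s₃) +ℚ ι s₄ +ℚ ι s₅         ≡⟨ cong (λ t → t +ℚ ι s₄ +ℚ ι s₅) (ι-+ (s₀ + s₁ + s₂) s₃) ⟩
    ι (s₀ + s₁ + s₂) +ℚ ι s₃ +ℚ ι s₄ +ℚ ι s₅      ≡⟨ cong (λ t → t +ℚ ι s₃ +ℚ ι s₄ +ℚ ι s₅) (ι-+ (s₀ + s₁) s₂) ⟩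
    ι (s₀ + s₁) +ℚ ι s₂ +ℚ ι s₃ +ℚ ι s₄ +ℚ ι s₅   ≡⟨ cong (λ t → t +ℚ ι s₂ +ℚ ι s₃ +ℚ ι s₄ +ℚ ι s₅) (ι-+ s₀ s₁) ⟩
    ι s₀ +ℚ ι s₁ +ℚ ι s₂ +ℚ ι s₃ +ℚ ι s₄ +ℚ ι s₅  ∎)
    where
    open ≡-Reasoning
    s₀ = s zero
    s₁ = s (suc zero)
    s₂ = s (suc (suc zero))
    s₃ = s (suc (suc (suc zero)))
    s₄ = s (suc (suc (suc (suc zero))))
    s₅ = s (suc (suc (suc (suc (suc zero)))))

  sum6-sides : ∀ p → sum6 (λ i → ι (side p i)) ≡ ι (2 * hexNorm p)
  sum6-sides p = trans (sum6-ι (side p)) (cong ι (perimeter p))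

  segSq≡ι-side² : ∀ p i → (+ segSq p i) / 1 ≡ ι (side p i) *ℚ ι (side p i)
  segSq≡ι-side² p i = trans (cong ι (segSq≡side² p i)) (ι-* (side p i) (side p i))

  approx≤side : ∀ {u} → LowerApprox u → ∀ p i → u p i ≤ℚ ι (side p i)
  approx≤side {u} approx p i =
    square-≤⇒≤ (ι-nonNeg (side p i)) (subst (u p i *ℚ u p i ≤ℚ_) (segSq≡ι-side² p i) (proj₂ (approx p i)))

  side≤approx : ∀ {v} → UpperApprox v → ∀ p i → ι (side p i) ≤ℚ v p i
  side≤approx {v} approx p i =
    square-≤⇒≤ (proj₁ (approx p i)) (subst (_≤ℚ v p i *ℚ v p i) (segSq≡ι-side² p i) (proj₂ (approx p i)))

  sumℚ-perimeters : ∀ T → sumℚ (map (λ p → ι (2 * hexNorm p)) (grid T)) ≡ ι (totalLength T)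
  sumℚ-perimeters T = trans (sumℚ-ι (grid T) (λ p → 2 * hexNorm p)) (cong ι (sum-grid-perimeters T))

  gridSum≤totalLength : ∀ T {u} → LowerApprox u → gridSum T u ≤ℚ ι (totalLength T)
  gridSum≤totalLength T {u} approx = begin
    gridSum T u                                    ≤⟨ sumℚ-mono (grid T) lengths-≤ ⟩
    sumℚ (map (λ p → ι (2 * hexNorm p)) (grid T))  ≡⟨ sumℚ-perimeters T ⟩
    ι (totalLength T)                              ∎
    where
    open ℚ.≤-Reasoning
    lengths-≤ : ∀ p → sum6 (u p) ≤ℚ ι (2 * hexNorm p)
    lengths-≤ p = subst (sum6 (u p) ≤ℚ_) (sum6-sides p) (sum6-mono (approx≤side approx p))

  totalLength≤gridSum : ∀ T {v} → UpperApprox v → ι (totalLength T) ≤ℚ gridSum T v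
  totalLength≤gridSum T {v} approx = begin
    ι (totalLength T)                              ≡⟨ sumℚ-perimeters T ⟨
    sumℚ (map (λ p → ι (2 * hexNorm p)) (grid T))  ≤⟨ sumℚ-mono (grid T) lengths-≥ ⟩
    gridSum T v                                    ∎
    where
    open ℚ.≤-Reasoning
    lengths-≥ : ∀ p → ι (2 * hexNorm p) ≤ℚ sum6 (v p)
    lengths-≥ p = subst (_≤ℚ sum6 (v p)) (sum6-sides p) (sum6-mono (side≤approx approx p))

  -- The bound holds for T = 0 as well.
  averageLength : Σ ℚ (λ C → (T : ℕ) → 1 ≤ T → AverageLengthBound C T)
  averageLength = ι 11 , λ T _ →
    (λ u approx → ℚ.≤-trans (gridSum≤totalLength T approx)
                            (ι-≤-affine (totalLength T) (17 * T) 11 (N T) (totalLength-upper T))) ,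
    (λ v approx → ℚ.≤-trans (affine-≤-ι (totalLength T) (17 * T) 11 (N T) (totalLength-lower T))
                            (totalLength≤gridSum T approx))
    where N = λ T → suc (2 * T) * suc (2 * T)

open AverageLength

theorem1p1 :
  -- (1)
  ((a b : ℤ) →
    (cyc (a , b) (fromℕ 5) ≡ (a , b)) ×
    (Σ (Fin 6) (λ i → OnSpecialLine (cyc (a , b) i)) →
      ((a ≡ + 1 × b ≡ + 1) → (i : Fin 6) → cyc (a , b) i ≡ (+ 1 , + 1)) ×
      (¬ (a ≡ + 1 × b ≡ + 1) → ExactlyThreeDistinct (cyc (a , b)))))
  ×
  -- (2)
  (((p q : Point) → SameCycle p q ⊎ DisjointCycles p q) ×
   ((r : Point) → Σ Point (λ p → Reach p r)) ×
   Σ ℚ (λ C → (T : ℕ) → 1 ≤ T → AverageLengthBound C T))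
  ×
  -- (3)
  (((L : List Point) → Σ Point (λ p → HasThreeDistinct IsSquare p × All (λ q → ¬ SameCycle q p) L)) ×
   ((L : List Point) → Σ Point (λ p → HasThreeDistinct IsCube p × All (λ q → ¬ SameCycle q p) L)) ×
   Σ Point (λ p → (m : ℕ) → InAbsCoords p m → Prime m))
theorem1p1 =
  (λ a b → cyc-period (a , b) , λ (i , onLine) →
    (λ { (refl , refl) l → centre-fixed (Reach-cyc centre l) }) ,
    λ not-centre → Degenerate⇒ExactlyThreeDistinct
      (Degenerate-Reach (Reach-cyc (a , b) i) (OnSpecialLine⇒Degenerate (cyc (a , b) i) onLine))
      (λ ab≡centre → not-centre (cong proj₁ ab≡centre , cong proj₂ ab≡centre))) ,
  (SameCycle⊎DisjointCycles , (λ r → r , here) , averageLength) ,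
  (squareCycles , cubeCycles , primeCycle)
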